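{- For positive integers $n,k,t$ with $k,t\le n$, \[\left[{n\atop k/t}\right]=\sum_{j=1}^{n}(j-1)!\binom{n-1}{j-1}\left[(k-1)\left[{n-j\atop k-1/t}\right]+\left[{n-j\atop k/t-1}\right]\right].\]
   Context: For integers $m\ge0$, $k\ge1$, $t\ge0$, a mixed coloured permutation of $[m]=\{1,\ldots,m\}$ is a permutation of $[m]$ together with a colouring of its cycles with colours from $\{1,\ldots,k\}$ such that exactly $t$ cycles receive colour $1$ (the special colour) and each of the colours $2,\ldots,k$ is used on exactly one cycle (so there are $t+k-1$ cycles; for $m=0$ the count is $1$ if $t+k-1=0$ and $0$ otherwise); $\left[{m\atop k/t}\right]$ denotes their number. A term multiplied by the coefficient $k-1=0$ is interpreted as $0$. -}

module Defs where

open import Data.Nat using (ℕ; zero; suc; _≤_; _≤?_)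
open import Data.Nat.Properties using () renaming (_≟_ to _≟ℕ_)
open import Data.Fin using (Fin; toℕ) renaming (zero to fzero; suc to fsuc)
open import Data.Fin.Properties using (all?; any?) renaming (_≟_ to _≟F_)
open import Data.List using (List; []; _∷_; map; concatMap; filter; length; allFin; cartesianProduct)
open import Data.Product using (_×_; _,_; ∃)
open import Function using (_∘_)
open import Relation.Binary.PropositionalEquality using (_≡_; _≢_)
open import Relation.Nullary using (Dec; ¬?)
open import Relation.Nullary.Decidable using (_×-dec_; _→-dec_)

consF : ∀ {m n} → Fin n → (Fin m → Fin n) → (Fin (suc m) → Fin n)
consF x f fzero    = x
consF x f (fsuc i) = f i

allFuns : (m n : ℕ) → List (Fin m → Fin n)
allFuns zero    n = (λ ()) ∷ []
allFuns (suc m) n = concatMap (λ f → map (λ x → consF x f) (allFin n)) (allFuns m n)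

iter : ∀ {m} → (Fin m → Fin m) → ℕ → Fin m → Fin m
iter f zero    i = i
iter f (suc r) i = f (iter f r i)

IsPerm : ∀ {m} → (Fin m → Fin m) → Set
IsPerm {m} f = (∀ i j → f i ≡ f j → i ≡ j) × (∀ j → ∃ λ i → f i ≡ j)

isPerm? : ∀ {m} (f : Fin m → Fin m) → Dec (IsPerm f)
isPerm? f = all? (λ i → all? (λ j → (f i ≟F f j) →-dec (i ≟F j)))
            ×-dec all? (λ j → any? (λ i → f i ≟F j))

-- i is the smallest element of its cycle under the permutation f
-- (the orbit of i is {f^r i : r < m}); used to count cycles, one leader per cycle.
IsLeader : ∀ {m} → (Fin m → Fin m) → Fin m → Set
IsLeader {m} f i = ∀ (r : Fin m) → toℕ i ≤ toℕ (iter f (toℕ r) i)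

isLeader? : ∀ {m} (f : Fin m → Fin m) (i : Fin m) → Dec (IsLeader f i)
isLeader? f i = all? (λ r → toℕ i ≤? toℕ (iter f (toℕ r) i))

-- A cycle colouring: c : Fin m → Fin k, constant on cycles of f.
-- Colour fzero plays the role of the special colour 1; colours fsuc _ are 2,…,k.
IsCycleColouring : ∀ {m k} → (Fin m → Fin m) → (Fin m → Fin k) → Set
IsCycleColouring f c = ∀ i → c (f i) ≡ c i

cyclesOfColour : ∀ {m k} → (Fin m → Fin m) → (Fin m → Fin k) → Fin k → ℕ
cyclesOfColour {m} f c col =
  length (filter (λ i → isLeader? f i ×-dec (c i ≟F col)) (allFin m))

-- (f , c) is a mixed coloured permutation of [m] with colours Fin (suc k')
-- (so k = suc k' colours), exactly t cycles of the special colour fzero,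
-- and each other colour on exactly one cycle.
IsMCP : (m k' t : ℕ) → (Fin m → Fin m) × (Fin m → Fin (suc k')) → Set
IsMCP m k' t (f , c) =
  IsPerm f × IsCycleColouring f c
  × (cyclesOfColour f c fzero ≡ t)
  × (∀ col → col ≢ fzero → cyclesOfColour f c col ≡ 1)

isMCP? : (m k' t : ℕ) → ∀ p → Dec (IsMCP m k' t p)
isMCP? m k' t (f , c) =
  isPerm? f
  ×-dec all? (λ i → c (f i) ≟F c i)
  ×-dec (cyclesOfColour f c fzero ≟ℕ t)
  ×-dec all? (λ col → ¬? (col ≟F fzero) →-dec (cyclesOfColour f c col ≟ℕ 1))

-- [ m , k / t ] : number of mixed coloured permutations.
-- k = 0 is outside the definition (k ≥ 1); it only occurs multiplied by the
-- coefficient k-1 = 0, which the paper interprets as 0, so we set it to 0.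
mcp : ℕ → ℕ → ℕ → ℕ
mcp m zero     t = 0
mcp m (suc k') t =
  length (filter (isMCP? m k' t) (cartesianProduct (allFuns m m) (allFuns m (suc k'))))

-- Write M(n) for mcp n k t.  Classify a mixed coloured permutation of
-- [m+1] by what happens to the new point `last` = m+1:
--   (1) last is not a fixed point: deleting it from its cycle leaves a
--       mixed coloured permutation of [m], and last can be re-inserted
--       after any of the m points, so this class has m · M(m) elements;
--   (2) last is a fixed point of the special colour: mcp m k (t-1);
--   (3) last is a fixed point of one of the k-1 other colours, which then
--       colours no other cycle: (k-1) · mcp m (k-1) t.
-- Hence  M(m+1) = m · M(m) + A(m)  with  A(m) = (k-1)·mcp m (k-1) t + mcp m k (t-1),
-- and unrolling gives  M(m+1) = Σ_{i ≤ m} i! · C(m,i) · A(m-i),  the statement.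
--
-- Since the counts are lengths of filtered enumerations of functions, and
-- functions are only equal pointwise, each class is counted by a
-- correspondence between finite setoids (section 2).
module Submission where

open import Defs
open import Data.Nat using (ℕ; _+_; _*_; _∸_; _≤_; suc; _!)
open import Data.Nat.Combinatorics using (_C_)
open import Data.List using (map; applyUpTo)
open import Data.Nat.ListAction using (sum)
open import Relation.Binary.PropositionalEquality using (_≡_)

open import Data.Nat using (zero; _<_; z≤n; s≤s)
open import Data.Nat.Properties
open import Data.Fin using (Fin; toℕ; fromℕ; fromℕ<; inject₁; punchIn; punchOut)
  renaming (zero to fzero; suc to fsuc)
import Data.Fin.Properties as FP
open import Data.List using (List; []; _∷_; _++_; filter; length; concatMap; cartesianProduct; allFin; tabulate)
open import Data.List.Properties using (length-tabulate)
open import Data.Product using (∃; _×_; _,_; proj₁; proj₂)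
open import Data.Sum using (_⊎_; inj₁; inj₂)
open import Data.Empty using (⊥; ⊥-elim)
open import Relation.Nullary using (Dec; yes; no; ¬_; ¬?)
open import Relation.Nullary.Decidable using (_×-dec_)
open import Relation.Binary.PropositionalEquality
  using (_≢_; refl; sym; trans; cong; cong₂; subst; subst₂; module ≡-Reasoning)
open import Function using (_∘_; id)
open import Algebra.Properties.CommutativeSemigroup +-commutativeSemigroup using (interchange)
open import Data.Nat.Combinatorics using (nCk≡n!/k![n-k]!; k>n⇒nCk≡0; k![n∸k]!∣n!; nCk≡nC[n∸k]; nCn≡1)
open import Data.Nat.DivMod using (m/n*n≡m; _%_; _/_; m%n<n; m≡m%n+[m/n]*n)
open import Data.Nat.Tactic.RingSolver using (solve-∀)

-- 1. Indicators and finite sums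

𝟙 : {P : Set} → Dec P → ℕ
𝟙 (yes _) = 1
𝟙 (no _)  = 0

𝟙-yes : {P : Set} (d : Dec P) → P → 𝟙 d ≡ 1
𝟙-yes (yes _) _ = refl
𝟙-yes (no ¬p) p = ⊥-elim (¬p p)

𝟙-no : {P : Set} (d : Dec P) → ¬ P → 𝟙 d ≡ 0
𝟙-no (yes p) ¬p = ⊥-elim (¬p p)
𝟙-no (no _)  _  = refl

𝟙-iff : {P Q : Set} (dP : Dec P) (dQ : Dec Q) → (P → Q) → (Q → P) → 𝟙 dP ≡ 𝟙 dQ
𝟙-iff (yes p) (yes q) _ _ = refl
𝟙-iff (yes p) (no ¬q) f _ = ⊥-elim (¬q (f p))
𝟙-iff (no ¬p) (yes q) _ g = ⊥-elim (¬p (g q))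
𝟙-iff (no ¬p) (no ¬q) _ _ = refl

𝟙-× : {P Q : Set} (dP : Dec P) (dQ : Dec Q) → 𝟙 dP * 𝟙 dQ ≡ 𝟙 (dP ×-dec dQ)
𝟙-× (yes _) (yes _) = refl
𝟙-× (yes _) (no _)  = refl
𝟙-× (no _)  (yes _) = refl
𝟙-× (no _)  (no _)  = refl

sumL : {A : Set} → List A → (A → ℕ) → ℕ
sumL []       w = 0
sumL (x ∷ xs) w = w x + sumL xs w

length-filter≡sumL : {A : Set} {P : A → Set} (P? : ∀ x → Dec (P x)) (l : List A) →
  length (filter P? l) ≡ sumL l (𝟙 ∘ P?)
length-filter≡sumL P? []      = refl
length-filter≡sumL P? (x ∷ l) with P? x
... | yes _ = cong suc (length-filter≡sumL P? l)
... | no _  = length-filter≡sumL P? l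

sumL-cong : {A : Set} (l : List A) {f g : A → ℕ} → (∀ x → f x ≡ g x) → sumL l f ≡ sumL l g
sumL-cong []      e = refl
sumL-cong (x ∷ l) e = cong₂ _+_ (e x) (sumL-cong l e)

sumL-0 : {A : Set} (l : List A) → sumL l (λ _ → 0) ≡ 0
sumL-0 []      = refl
sumL-0 (x ∷ l) = sumL-0 l

sumL-+ : {A : Set} (l : List A) (f g : A → ℕ) → sumL l (λ x → f x + g x) ≡ sumL l f + sumL l g
sumL-+ []      f g = refl
sumL-+ (x ∷ l) f g = trans (cong (f x + g x +_) (sumL-+ l f g)) (interchange (f x) (g x) (sumL l f) (sumL l g))

sumL-*ˡ : {A : Set} (l : List A) (c : ℕ) (f : A → ℕ) → sumL l (λ x → c * f x) ≡ c * sumL l f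
sumL-*ˡ []      c f = sym (*-zeroʳ c)
sumL-*ˡ (x ∷ l) c f = trans (cong (c * f x +_) (sumL-*ˡ l c f)) (sym (*-distribˡ-+ c (f x) (sumL l f)))

sumL-*ʳ : {A : Set} (l : List A) (c : ℕ) (f : A → ℕ) → sumL l (λ x → f x * c) ≡ sumL l f * c
sumL-*ʳ l c f = trans (sumL-cong l (λ x → *-comm (f x) c)) (trans (sumL-*ˡ l c f) (*-comm c (sumL l f)))

sumL-const : {A : Set} (l : List A) (c : ℕ) → sumL l (λ _ → c) ≡ c * length l
sumL-const []      c = sym (*-zeroʳ c)
sumL-const (x ∷ l) c = trans (cong (c +_) (sumL-const l c)) (sym (*-suc c (length l)))

sumL-++ : {A : Set} (l l' : List A) (f : A → ℕ) → sumL (l ++ l') f ≡ sumL l f + sumL l' f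
sumL-++ []      l' f = refl
sumL-++ (x ∷ l) l' f = trans (cong (f x +_) (sumL-++ l l' f)) (sym (+-assoc (f x) (sumL l f) (sumL l' f)))

sumL-map : {A B : Set} (g : A → B) (l : List A) (f : B → ℕ) → sumL (map g l) f ≡ sumL l (f ∘ g)
sumL-map g []      f = refl
sumL-map g (x ∷ l) f = cong (f (g x) +_) (sumL-map g l f)

sumL-concatMap : {A B : Set} (g : A → List B) (l : List A) (f : B → ℕ) →
  sumL (concatMap g l) f ≡ sumL l (λ x → sumL (g x) f)
sumL-concatMap g []      f = refl
sumL-concatMap g (x ∷ l) f =
  trans (sumL-++ (g x) (concatMap g l) f) (cong (sumL (g x) f +_) (sumL-concatMap g l f))

sumL-cartesian : {A B : Set} (l : List A) (l' : List B) (f : A × B → ℕ) →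
  sumL (cartesianProduct l l') f ≡ sumL l (λ a → sumL l' (λ b → f (a , b)))
sumL-cartesian []      l' f = refl
sumL-cartesian (x ∷ l) l' f =
  trans (sumL-++ (map (x ,_) l') _ f) (cong₂ _+_ (sumL-map (x ,_) l' f) (sumL-cartesian l l' f))

sumL-swap : {A B : Set} (l : List A) (l' : List B) (f : A → B → ℕ) →
  sumL l (λ a → sumL l' (f a)) ≡ sumL l' (λ b → sumL l (λ a → f a b))
sumL-swap []      l' f = sym (sumL-0 l')
sumL-swap (x ∷ l) l' f =
  trans (cong (sumL l' (f x) +_) (sumL-swap l l' f)) (sym (sumL-+ l' (f x) (λ b → sumL l (λ a → f a b))))

sumL-cartesian-fst : {A B : Set} (l : List A) (l' : List B) (f : A → ℕ) →
  sumL (cartesianProduct l l') (f ∘ proj₁) ≡ sumL l f * length l'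
sumL-cartesian-fst l l' f =
  trans (sumL-cartesian l l' _) (trans (sumL-cong l (λ a → sumL-const l' (f a))) (sumL-*ʳ l (length l') f))

sumL-cartesian-snd : {A B : Set} (l : List A) (l' : List B) (f : B → ℕ) →
  sumL (cartesianProduct l l') (f ∘ proj₂) ≡ length l * sumL l' f
sumL-cartesian-snd []      l' f = refl
sumL-cartesian-snd (x ∷ l) l' f =
  trans (sumL-++ (map (x ,_) l') _ _) (cong₂ _+_ (sumL-map (x ,_) l' _) (sumL-cartesian-snd l l' f))

sumFin : ∀ {n} → (Fin n → ℕ) → ℕ
sumFin {zero}  w = 0
sumFin {suc n} w = w fzero + sumFin (w ∘ fsuc)

sumL-allFin : ∀ n (f : Fin n → ℕ) → sumL (allFin n) f ≡ sumFin f
sumL-allFin n = go id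
  where
  go : ∀ {A : Set} {n} (g : Fin n → A) (f : A → ℕ) → sumL (tabulate g) f ≡ sumFin (f ∘ g)
  go {n = zero}  g f = refl
  go {n = suc n} g f = cong (f (g fzero) +_) (go (g ∘ fsuc) f)

sumFin-cong : ∀ {n} {f g : Fin n → ℕ} → (∀ x → f x ≡ g x) → sumFin f ≡ sumFin g
sumFin-cong {zero}  e = refl
sumFin-cong {suc n} e = cong₂ _+_ (e fzero) (sumFin-cong (e ∘ fsuc))

sumFin-last : ∀ n (w : Fin (suc n) → ℕ) → sumFin w ≡ sumFin (w ∘ inject₁) + w (fromℕ n)
sumFin-last zero    w = +-comm (w fzero) 0
sumFin-last (suc n) w =
  trans (cong (w fzero +_) (sumFin-last n (w ∘ fsuc))) (sym (+-assoc (w fzero) _ _))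

sumFin-0 : ∀ {n} (w : Fin n → ℕ) → (∀ x → w x ≡ 0) → sumFin w ≡ 0
sumFin-0 {zero}  w e = refl
sumFin-0 {suc n} w e = trans (cong (_+ sumFin (w ∘ fsuc)) (e fzero)) (sumFin-0 (w ∘ fsuc) (e ∘ fsuc))

sumFin-point : ∀ {n} (w : Fin n → ℕ) (a : Fin n) → w a ≡ 1 → (∀ x → x ≢ a → w x ≡ 0) → sumFin w ≡ 1
sumFin-point w fzero    e1 e0 =
  cong₂ _+_ e1 (sumFin-0 (w ∘ fsuc) (λ x → e0 (fsuc x) (λ ())))
sumFin-point w (fsuc a) e1 e0 =
  cong₂ _+_ (e0 fzero (λ ())) (sumFin-point (w ∘ fsuc) a e1 (λ x ne → e0 (fsuc x) (ne ∘ FP.suc-injective)))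

sumFin-≥ : ∀ {n} (w : Fin n → ℕ) a → w a ≤ sumFin w
sumFin-≥ w fzero    = m≤m+n (w fzero) _
sumFin-≥ w (fsuc a) = ≤-trans (sumFin-≥ (w ∘ fsuc) a) (m≤n+m _ (w fzero))

-- 2. Finite setoids and counting by correspondence

record FiniteSetoid (A : Set) : Set₁ where
  field
    _≈_       : A → A → Set
    _≈?_      : ∀ x y → Dec (x ≈ y)
    ≈-refl    : ∀ {x} → x ≈ x
    ≈-sym     : ∀ {x y} → x ≈ y → y ≈ x
    ≈-trans   : ∀ {x y z} → x ≈ y → y ≈ z → x ≈ z
    enum      : List A
    enum-once : ∀ a → sumL enum (λ x → 𝟙 (x ≈? a)) ≡ 1

  count : {P : A → Set} → (∀ x → Dec (P x)) → ℕ
  count P? = sumL enum (𝟙 ∘ P?)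

open FiniteSetoid using (count)

record Correspondence {A B : Set} (FA : FiniteSetoid A) (FB : FiniteSetoid B)
                      (P : A → Set) (Q : B → Set) : Set where
  open FiniteSetoid FA using () renaming (_≈_ to _≈ᴬ_)
  open FiniteSetoid FB using () renaming (_≈_ to _≈ᴮ_)
  field
    to        : A → B
    from      : B → A
    to-cong   : ∀ {x x'} → P x → x ≈ᴬ x' → to x ≈ᴮ to x'
    from-cong : ∀ {y y'} → Q y → y ≈ᴮ y' → from y ≈ᴬ from y'
    P-resp    : ∀ {x x'} → x ≈ᴬ x' → P x → P x'
    Q-resp    : ∀ {y y'} → y ≈ᴮ y' → Q y → Q y'
    to-Q      : ∀ x → P x → Q (to x)
    to-Q⁻     : ∀ x → Q (to x) → P x
    from-to   : ∀ x → P x → from (to x) ≈ᴬ x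
    to-from   : ∀ y → Q y → to (from y) ≈ᴮ y

-- Corresponding predicates have equally many solutions: both counts equal
-- the number of pairs (x , y) with P x and y ≈ to x.
count-correspondence : {A B : Set} {FA : FiniteSetoid A} {FB : FiniteSetoid B}
  {P : A → Set} {Q : B → Set} (P? : ∀ x → Dec (P x)) (Q? : ∀ y → Dec (Q y)) →
  Correspondence FA FB P Q → count FA P? ≡ count FB Q?
count-correspondence {FA = FA} {FB} {P} {Q} P? Q? φ = begin
    sumL A.enum (λ x → 𝟙 (P? x))
      ≡⟨ sumL-cong A.enum (λ x → sym (trans (cong (𝟙 (P? x) *_) (B.enum-once (to x))) (*-identityʳ _))) ⟩
    sumL A.enum (λ x → 𝟙 (P? x) * sumL B.enum (λ y → 𝟙 (y B.≈? to x)))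
      ≡⟨ sumL-cong A.enum (λ x → sym (sumL-*ˡ B.enum (𝟙 (P? x)) _)) ⟩
    sumL A.enum (λ x → sumL B.enum (λ y → 𝟙 (P? x) * 𝟙 (y B.≈? to x)))
      ≡⟨ sumL-cong A.enum (λ x → sumL-cong B.enum (pairs x)) ⟩
    sumL A.enum (λ x → sumL B.enum (λ y → 𝟙 (Q? y) * 𝟙 (x A.≈? from y)))
      ≡⟨ sumL-swap A.enum B.enum _ ⟩
    sumL B.enum (λ y → sumL A.enum (λ x → 𝟙 (Q? y) * 𝟙 (x A.≈? from y)))
      ≡⟨ sumL-cong B.enum (λ y → sumL-*ˡ A.enum (𝟙 (Q? y)) _) ⟩
    sumL B.enum (λ y → 𝟙 (Q? y) * sumL A.enum (λ x → 𝟙 (x A.≈? from y)))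
      ≡⟨ sumL-cong B.enum (λ y → trans (cong (𝟙 (Q? y) *_) (A.enum-once (from y))) (*-identityʳ _)) ⟩
    sumL B.enum (λ y → 𝟙 (Q? y)) ∎
  where
  open ≡-Reasoning
  module A = FiniteSetoid FA
  module B = FiniteSetoid FB
  open Correspondence φ
  from-P : ∀ y → Q y → P (from y)
  from-P y qy = to-Q⁻ (from y) (Q-resp (B.≈-sym (to-from y qy)) qy)
  pairs : ∀ x y → 𝟙 (P? x) * 𝟙 (y B.≈? to x) ≡ 𝟙 (Q? y) * 𝟙 (x A.≈? from y)
  pairs x y = trans (𝟙-× (P? x) (y B.≈? to x)) (trans (𝟙-iff _ _
    (λ (px , e) → Q-resp (B.≈-sym e) (to-Q x px) ,
                  A.≈-trans (A.≈-sym (from-to x px)) (from-cong (to-Q x px) (B.≈-sym e)))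
    (λ (qy , e) → P-resp (A.≈-sym e) (from-P y qy) ,
                  B.≈-trans (B.≈-sym (to-from y qy)) (to-cong (from-P y qy) (A.≈-sym e))))
    (sym (𝟙-× (Q? y) (x A.≈? from y))))

finSetoid : ∀ n → FiniteSetoid (Fin n)
finSetoid n = record
  { _≈_ = _≡_ ; _≈?_ = FP._≟_ ; ≈-refl = refl ; ≈-sym = sym ; ≈-trans = trans
  ; enum = allFin n
  ; enum-once = λ a → trans (sumL-allFin n _)
      (sumFin-point _ a (𝟙-yes (a FP.≟ a) refl) (λ x ne → 𝟙-no (x FP.≟ a) ne)) }

_≗_ : ∀ {m n} → (Fin m → Fin n) → (Fin m → Fin n) → Set
f ≗ g = ∀ i → f i ≡ g i

_≗?_ : ∀ {m n} (f g : Fin m → Fin n) → Dec (f ≗ g)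
f ≗? g = FP.all? (λ i → f i FP.≟ g i)

allFuns-once : ∀ m n (f : Fin m → Fin n) → sumL (allFuns m n) (λ g → 𝟙 (g ≗? f)) ≡ 1
allFuns-once zero    n f = 𝟙-yes ((λ ()) ≗? f) (λ ())
allFuns-once (suc m) n f = begin
    sumL (allFuns (suc m) n) (λ g → 𝟙 (g ≗? f))
      ≡⟨ sumL-concatMap (λ h → map (λ x → consF x h) (allFin n)) (allFuns m n) _ ⟩
    sumL (allFuns m n) (λ h → sumL (map (λ x → consF x h) (allFin n)) (λ g → 𝟙 (g ≗? f)))
      ≡⟨ sumL-cong (allFuns m n) (λ h → sumL-map _ (allFin n) _) ⟩
    sumL (allFuns m n) (λ h → sumL (allFin n) (λ x → 𝟙 (consF x h ≗? f)))
      ≡⟨ sumL-cong (allFuns m n) (λ h → sumL-cong (allFin n) (λ x → split-cons x h)) ⟩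
    sumL (allFuns m n) (λ h → sumL (allFin n) (λ x → 𝟙 (x FP.≟ f fzero) * 𝟙 (h ≗? (f ∘ fsuc))))
      ≡⟨ sumL-cong (allFuns m n) (λ h → sumL-*ʳ (allFin n) _ _) ⟩
    sumL (allFuns m n) (λ h → sumL (allFin n) (λ x → 𝟙 (x FP.≟ f fzero)) * 𝟙 (h ≗? (f ∘ fsuc)))
      ≡⟨ sumL-cong (allFuns m n) (λ h → cong (_* 𝟙 (h ≗? (f ∘ fsuc))) (FiniteSetoid.enum-once (finSetoid n) (f fzero))) ⟩
    sumL (allFuns m n) (λ h → 1 * 𝟙 (h ≗? (f ∘ fsuc)))
      ≡⟨ sumL-cong (allFuns m n) (λ h → *-identityˡ _) ⟩
    sumL (allFuns m n) (λ h → 𝟙 (h ≗? (f ∘ fsuc)))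
      ≡⟨ allFuns-once m n (f ∘ fsuc) ⟩
    1 ∎
  where
  open ≡-Reasoning
  split-cons : ∀ x h → 𝟙 (consF x h ≗? f) ≡ 𝟙 (x FP.≟ f fzero) * 𝟙 (h ≗? (f ∘ fsuc))
  split-cons x h = trans
    (𝟙-iff _ ((x FP.≟ f fzero) ×-dec (h ≗? (f ∘ fsuc)))
      (λ e → e fzero , (λ i → e (fsuc i)))
      (λ { (e₀ , e₊) fzero → e₀ ; (e₀ , e₊) (fsuc i) → e₊ i }))
    (sym (𝟙-× (x FP.≟ f fzero) (h ≗? (f ∘ fsuc))))

funSetoid : ∀ m n → FiniteSetoid (Fin m → Fin n)
funSetoid m n = record
  { _≈_ = _≗_ ; _≈?_ = _≗?_ ; ≈-refl = λ _ → refl ; ≈-sym = λ e i → sym (e i)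
  ; ≈-trans = λ e e' i → trans (e i) (e' i)
  ; enum = allFuns m n ; enum-once = allFuns-once m n }

_×ₛ_ : {A B : Set} → FiniteSetoid A → FiniteSetoid B → FiniteSetoid (A × B)
_×ₛ_ {A} {B} FA FB = record
  { _≈_ = λ p q → (proj₁ p A.≈ proj₁ q) × (proj₂ p B.≈ proj₂ q)
  ; _≈?_ = λ p q → (proj₁ p A.≈? proj₁ q) ×-dec (proj₂ p B.≈? proj₂ q)
  ; ≈-refl = A.≈-refl , B.≈-refl
  ; ≈-sym = λ (e₁ , e₂) → A.≈-sym e₁ , B.≈-sym e₂
  ; ≈-trans = λ (e₁ , e₂) (e₁' , e₂') → A.≈-trans e₁ e₁' , B.≈-trans e₂ e₂'
  ; enum = cartesianProduct A.enum B.enum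
  ; enum-once = enum-once }
  where
  module A = FiniteSetoid FA
  module B = FiniteSetoid FB
  enum-once : ∀ p → sumL (cartesianProduct A.enum B.enum)
                      (λ q → 𝟙 ((proj₁ q A.≈? proj₁ p) ×-dec (proj₂ q B.≈? proj₂ p))) ≡ 1
  enum-once (a , b) = trans (sumL-cartesian A.enum B.enum _)
    (trans (sumL-cong A.enum (λ x → begin
        sumL B.enum (λ y → 𝟙 ((x A.≈? a) ×-dec (y B.≈? b)))
          ≡⟨ sumL-cong B.enum (λ y → sym (𝟙-× (x A.≈? a) (y B.≈? b))) ⟩
        sumL B.enum (λ y → 𝟙 (x A.≈? a) * 𝟙 (y B.≈? b))
          ≡⟨ sumL-*ˡ B.enum (𝟙 (x A.≈? a)) _ ⟩
        𝟙 (x A.≈? a) * sumL B.enum (λ y → 𝟙 (y B.≈? b))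
          ≡⟨ cong (𝟙 (x A.≈? a) *_) (B.enum-once b) ⟩
        𝟙 (x A.≈? a) * 1
          ≡⟨ *-identityʳ _ ⟩
        𝟙 (x A.≈? a) ∎))
      (A.enum-once a))
    where open ≡-Reasoning

count-×ˡ : {A B : Set} (FA : FiniteSetoid A) (FB : FiniteSetoid B) {P : A → Set} (P? : ∀ x → Dec (P x)) →
  count (FA ×ₛ FB) (P? ∘ proj₁) ≡ count FA P? * length (FiniteSetoid.enum FB)
count-×ˡ FA FB P? = sumL-cartesian-fst (FiniteSetoid.enum FA) (FiniteSetoid.enum FB) (𝟙 ∘ P?)

count-×ʳ : {A B : Set} (FA : FiniteSetoid A) (FB : FiniteSetoid B) {Q : B → Set} (Q? : ∀ y → Dec (Q y)) →
  count (FA ×ₛ FB) (Q? ∘ proj₂) ≡ length (FiniteSetoid.enum FA) * count FB Q?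
count-×ʳ FA FB Q? = sumL-cartesian-snd (FiniteSetoid.enum FA) (FiniteSetoid.enum FB) (𝟙 ∘ Q?)

𝟙-partition : {X Y : Set} (x? : Dec X) (y? : Dec Y) →
  𝟙 (¬? x?) + 𝟙 (x? ×-dec y?) + 𝟙 (x? ×-dec ¬? y?) ≡ 1
𝟙-partition (yes _) (yes _) = refl
𝟙-partition (yes _) (no _)  = refl
𝟙-partition (no _)  (yes _) = refl
𝟙-partition (no _)  (no _)  = refl

count-split₃ : {A : Set} (FA : FiniteSetoid A) {P Q₁ Q₂ Q₃ : A → Set} (P? : ∀ x → Dec (P x))
  (Q₁? : ∀ x → Dec (Q₁ x)) (Q₂? : ∀ x → Dec (Q₂ x)) (Q₃? : ∀ x → Dec (Q₃ x)) →
  (∀ x → 𝟙 (Q₁? x) + 𝟙 (Q₂? x) + 𝟙 (Q₃? x) ≡ 1) →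
  count FA P? ≡ count FA (λ x → P? x ×-dec Q₁? x) + count FA (λ x → P? x ×-dec Q₂? x)
                + count FA (λ x → P? x ×-dec Q₃? x)
count-split₃ FA P? Q₁? Q₂? Q₃? exactly-one =
  trans (sumL-cong enum pointwise)
        (trans (sumL-+ enum (λ x → w₁ x + w₂ x) w₃) (cong (_+ sumL enum w₃) (sumL-+ enum w₁ w₂)))
  where
  open FiniteSetoid FA using (enum)
  w₁ w₂ w₃ : _ → ℕ
  w₁ x = 𝟙 (P? x ×-dec Q₁? x)
  w₂ x = 𝟙 (P? x ×-dec Q₂? x)
  w₃ x = 𝟙 (P? x ×-dec Q₃? x)
  pointwise : ∀ x → 𝟙 (P? x) ≡ w₁ x + w₂ x + w₃ x
  pointwise x = begin
    𝟙 (P? x)                                                       ≡⟨ sym (*-identityʳ _) ⟩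
    𝟙 (P? x) * 1                                                   ≡⟨ cong (𝟙 (P? x) *_) (sym (exactly-one x)) ⟩
    𝟙 (P? x) * (𝟙 (Q₁? x) + 𝟙 (Q₂? x) + 𝟙 (Q₃? x))                 ≡⟨ *-distribˡ-+ (𝟙 (P? x)) _ _ ⟩
    𝟙 (P? x) * (𝟙 (Q₁? x) + 𝟙 (Q₂? x)) + 𝟙 (P? x) * 𝟙 (Q₃? x)      ≡⟨ cong (_+ 𝟙 (P? x) * 𝟙 (Q₃? x)) (*-distribˡ-+ (𝟙 (P? x)) _ _) ⟩
    𝟙 (P? x) * 𝟙 (Q₁? x) + 𝟙 (P? x) * 𝟙 (Q₂? x) + 𝟙 (P? x) * 𝟙 (Q₃? x)
      ≡⟨ cong₂ _+_ (cong₂ _+_ (𝟙-× (P? x) (Q₁? x)) (𝟙-× (P? x) (Q₂? x))) (𝟙-× (P? x) (Q₃? x)) ⟩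
    w₁ x + w₂ x + w₃ x ∎
    where open ≡-Reasoning

-- 3. Iterates and cycle leaders

IsInjective : ∀ {n} → (Fin n → Fin n) → Set
IsInjective f = ∀ i j → f i ≡ f j → i ≡ j

iter-+ : ∀ {n} (f : Fin n → Fin n) a b x → iter f (a + b) x ≡ iter f a (iter f b x)
iter-+ f zero    b x = refl
iter-+ f (suc a) b x = cong f (iter-+ f a b x)

iter-comm : ∀ {n} (f : Fin n → Fin n) a b x → iter f a (iter f b x) ≡ iter f b (iter f a x)
iter-comm f a b x =
  trans (sym (iter-+ f a b x)) (trans (cong (λ r → iter f r x) (+-comm a b)) (iter-+ f b a x))

iter-cong : ∀ {n} {f g : Fin n → Fin n} → f ≗ g → ∀ r x → iter f r x ≡ iter g r x
iter-cong e zero    x = refl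
iter-cong {f = f} {g} e (suc r) x = trans (e (iter f r x)) (cong g (iter-cong e r x))

iter-injective : ∀ {n} {f : Fin n → Fin n} → IsInjective f → ∀ r {x y} → iter f r x ≡ iter f r y → x ≡ y
iter-injective inj zero    e = e
iter-injective inj (suc r) e = iter-injective inj r (inj _ _ e)

iter-fixed : ∀ {n} (f : Fin n → Fin n) x → f x ≡ x → ∀ r → iter f r x ≡ x
iter-fixed f x e zero    = refl
iter-fixed f x e (suc r) = trans (cong f (iter-fixed f x e r)) e

-- Every point of [n] returns to itself after d steps for some 0 < d ≤ n
-- (pigeonhole on the first n+1 iterates, then cancel by injectivity).
period : ∀ {n} {f : Fin n → Fin n} → IsInjective f → ∀ i → ∃ λ d → 0 < d × d ≤ n × iter f d i ≡ i
period {n} {f} inj i with FP.pigeonhole (n<1+n n) (λ (a : Fin (suc n)) → iter f (toℕ a) i)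
... | a , b , a<b , e = toℕ b ∸ toℕ a , m<n⇒0<n∸m a<b ,
        ≤-trans (m∸n≤m (toℕ b) (toℕ a)) (≤-pred (FP.toℕ<n b)) ,
        iter-injective inj (toℕ a) (sym (begin
          iter f (toℕ a) i                               ≡⟨ e ⟩
          iter f (toℕ b) i                               ≡⟨ cong (λ r → iter f r i) (sym (m∸n+n≡m (<⇒≤ a<b))) ⟩
          iter f (toℕ b ∸ toℕ a + toℕ a) i               ≡⟨ iter-+ f (toℕ b ∸ toℕ a) (toℕ a) i ⟩
          iter f (toℕ b ∸ toℕ a) (iter f (toℕ a) i)      ≡⟨ iter-comm f (toℕ b ∸ toℕ a) (toℕ a) i ⟩
          iter f (toℕ a) (iter f (toℕ b ∸ toℕ a) i) ∎))
  where open ≡-Reasoning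

iter-multiple : ∀ {n} (f : Fin n → Fin n) i d → iter f d i ≡ i → ∀ q → iter f (q * d) i ≡ i
iter-multiple f i d e zero    = refl
iter-multiple f i d e (suc q) =
  trans (iter-+ f d (q * d) i) (trans (cong (iter f d) (iter-multiple f i d e q)) e)

iter-reduce : ∀ {n} {f : Fin n → Fin n} → IsInjective f → ∀ i R →
  ∃ λ (s : Fin n) → iter f R i ≡ iter f (toℕ s) i
iter-reduce {n} {f} inj i R with period inj i
... | suc d' , _ , d≤n , e = fromℕ< R%d<n , (begin
    iter f R i                                  ≡⟨ cong (λ r → iter f r i) (m≡m%n+[m/n]*n R d) ⟩
    iter f (R % d + (R / d) * d) i              ≡⟨ iter-+ f (R % d) ((R / d) * d) i ⟩
    iter f (R % d) (iter f ((R / d) * d) i)     ≡⟨ cong (iter f (R % d)) (iter-multiple f i d e (R / d)) ⟩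
    iter f (R % d) i                            ≡⟨ cong (λ r → iter f r i) (sym (FP.toℕ-fromℕ< R%d<n)) ⟩
    iter f (toℕ (fromℕ< R%d<n)) i ∎)
  where
  open ≡-Reasoning
  d = suc d'
  R%d<n : R % d < n
  R%d<n = ≤-trans (m%n<n R d) d≤n

-- IsLeader only inspects the first n iterates; this is the condition on all of them.
IsLeader∞ : ∀ {n} → (Fin n → Fin n) → Fin n → Set
IsLeader∞ f i = ∀ r → toℕ i ≤ toℕ (iter f r i)

leader⇒leader∞ : ∀ {n} {f : Fin n → Fin n} → IsInjective f → ∀ i → IsLeader f i → IsLeader∞ f i
leader⇒leader∞ {f = f} inj i L r with iter-reduce inj i r
... | s , e = subst (λ z → toℕ i ≤ toℕ z) (sym e) (L s)

leader∞⇒leader : ∀ {n} {f : Fin n → Fin n} i → IsLeader∞ f i → IsLeader f i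
leader∞⇒leader i L r = L (toℕ r)

leader-cong : ∀ {n} {f f' : Fin n → Fin n} → f ≗ f' → ∀ i → IsLeader f i → IsLeader f' i
leader-cong e i L r = subst (λ z → toℕ i ≤ toℕ z) (iter-cong e (toℕ r) i) (L r)

leader-fixed : ∀ {n} (f : Fin n → Fin n) x → f x ≡ x → IsLeader f x
leader-fixed f x e r = subst (λ z → toℕ x ≤ toℕ z) (sym (iter-fixed f x e (toℕ r))) ≤-refl

minimiser : ∀ {n} (w : Fin (suc n) → ℕ) → ∃ λ a → ∀ x → w a ≤ w x
minimiser {zero}  w = fzero , λ { fzero → ≤-refl }
minimiser {suc n} w with minimiser (w ∘ fsuc)
... | a , min with w fzero ≤? w (fsuc a)
... | yes w0≤ = fzero , λ { fzero → ≤-refl ; (fsuc x) → ≤-trans w0≤ (min x) }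
... | no w0≰  = fsuc a , λ { fzero → <⇒≤ (≰⇒> w0≰) ; (fsuc x) → min x }

-- Every cycle has a leader: the smallest of the first n iterates.
orbit-leader : ∀ {n} {f : Fin n → Fin n} → IsInjective f → ∀ i → ∃ λ r → IsLeader f (iter f r i)
orbit-leader {suc n} {f} inj i with minimiser (λ (r : Fin (suc n)) → toℕ (iter f (toℕ r) i))
... | a , min = toℕ a , λ r → let s , e = iter-reduce inj i (toℕ r + toℕ a) in
   subst (λ z → toℕ (iter f (toℕ a) i) ≤ toℕ z) (sym (trans (sym (iter-+ f (toℕ r) (toℕ a) i)) e)) (min s)

colour-iter : ∀ {n k} {f : Fin n → Fin n} {c : Fin n → Fin k} → IsCycleColouring f c →
  ∀ r i → c (iter f r i) ≡ c i
colour-iter cc zero    i = refl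
colour-iter {f = f} cc (suc r) i = trans (cc (iter f r i)) (colour-iter cc r i)

-- 4. Cycle counts and mixed coloured permutations as a count

leaderOf? : ∀ {m k} (f : Fin m → Fin m) (c : Fin m → Fin k) col i → Dec (IsLeader f i × c i ≡ col)
leaderOf? f c col i = isLeader? f i ×-dec (c i FP.≟ col)

cycles≡sumFin : ∀ {m k} (f : Fin m → Fin m) (c : Fin m → Fin k) col →
  cyclesOfColour f c col ≡ sumFin (𝟙 ∘ leaderOf? f c col)
cycles≡sumFin {m} f c col = trans (length-filter≡sumL _ (allFin m)) (sumL-allFin m _)

cycles-cong : ∀ {m k} {f f' : Fin m → Fin m} {c c' : Fin m → Fin k} → f ≗ f' → c ≗ c' → ∀ col →
  cyclesOfColour f c col ≡ cyclesOfColour f' c' col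
cycles-cong {f = f} {f'} {c} {c'} ef ec col = trans (cycles≡sumFin f c col) (trans (sumFin-cong (λ i →
  𝟙-iff (leaderOf? f c col i) (leaderOf? f' c' col i)
    (λ (L , e) → leader-cong ef i L , trans (sym (ec i)) e)
    (λ (L , e) → leader-cong (λ x → sym (ef x)) i L , trans (ec i) e))) (sym (cycles≡sumFin f' c' col)))

cycles-recolour : ∀ {m k k'} (f : Fin m → Fin m) (c : Fin m → Fin k) (σ : Fin k → Fin k') →
  (∀ a b → σ a ≡ σ b → a ≡ b) → ∀ col → cyclesOfColour f (σ ∘ c) (σ col) ≡ cyclesOfColour f c col
cycles-recolour f c σ σ-inj col = trans (cycles≡sumFin f (σ ∘ c) (σ col)) (trans (sumFin-cong (λ i →
  𝟙-iff (leaderOf? f (σ ∘ c) (σ col) i) (leaderOf? f c col i)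
    (λ (L , e) → L , σ-inj _ _ e) (λ (L , e) → L , cong σ e))) (sym (cycles≡sumFin f c col)))

cycles-absent : ∀ {m k} (f : Fin m → Fin m) (c : Fin m → Fin k) col → (∀ i → c i ≢ col) →
  cyclesOfColour f c col ≡ 0
cycles-absent f c col none = trans (cycles≡sumFin f c col)
  (sumFin-0 (𝟙 ∘ leaderOf? f c col) (λ i → 𝟙-no (leaderOf? f c col i) (λ (_ , e) → none i e)))

isMCP-cong : ∀ {m k' t} {f f' : Fin m → Fin m} {c c' : Fin m → Fin (suc k')} → f ≗ f' → c ≗ c' →
  IsMCP m k' t (f , c) → IsMCP m k' t (f' , c')
isMCP-cong {f = f} {f'} {c} {c'} ef ec ((inj , surj) , cc , special , others) =
  ((λ i j e → inj i j (trans (ef i) (trans e (sym (ef j))))) ,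
   (λ j → let i , e = surj j in i , trans (sym (ef i)) e)) ,
  (λ i → trans (sym (ec (f' i))) (trans (cong c (sym (ef i))) (trans (cc i) (ec i)))) ,
  trans (sym (cycles-cong ef ec fzero)) special ,
  (λ col ne → trans (sym (cycles-cong ef ec col)) (others col ne))

Pairs : ℕ → ℕ → Set
Pairs m k' = (Fin m → Fin m) × (Fin m → Fin (suc k'))

pairSetoid : ∀ m k' → FiniteSetoid (Pairs m k')
pairSetoid m k' = funSetoid m m ×ₛ funSetoid m (suc k')

mcp≡count : ∀ m k' t → mcp m (suc k') t ≡ count (pairSetoid m k') (isMCP? m k' t)
mcp≡count m k' t = length-filter≡sumL (isMCP? m k' t) (cartesianProduct (allFuns m m) (allFuns m (suc k')))

-- 5. Adjoining a new largest point `last` to [m]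

data View {m : ℕ} : Fin (suc m) → Set where
  isLast : View (fromℕ m)
  isOld  : (i : Fin m) → View (inject₁ i)

view : ∀ {m} (x : Fin (suc m)) → View x
view {zero}  fzero    = isLast
view {suc m} fzero    = isOld fzero
view {suc m} (fsuc x) with view x
... | isLast  = isLast
... | isOld i = isOld (fsuc i)

view-old : ∀ {m} (i : Fin m) → view (inject₁ i) ≡ isOld i
view-old {suc m} fzero    = refl
view-old {suc m} (fsuc i) rewrite view-old i = refl

view-last : ∀ m → view (fromℕ m) ≡ isLast
view-last zero    = refl
view-last (suc m) rewrite view-last m = refl

module Extension {m : ℕ} where

  last : Fin (suc m)
  last = fromℕ m

  last≢old : ∀ i → last ≢ inject₁ i
  last≢old i = FP.fromℕ≢inject₁

  splitLast : (x : Fin (suc m)) → (x ≡ last) ⊎ (∃ λ j → x ≡ inject₁ j)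
  splitLast x with view x
  ... | isLast  = inj₁ refl
  ... | isOld j = inj₂ (j , refl)

  -- glue a b is a at last and b on the old points; kept abstract so that
  -- it is only ever used through the two computation rules.
  abstract
    glue : {A : Set} → A → (Fin m → A) → Fin (suc m) → A
    glue a b x with view x
    ... | isLast  = a
    ... | isOld i = b i

    glue-last : {A : Set} (a : A) (b : Fin m → A) → glue a b last ≡ a
    glue-last a b rewrite view-last m = refl

    glue-old : {A : Set} (a : A) (b : Fin m → A) (i : Fin m) → glue a b (inject₁ i) ≡ b i
    glue-old a b i rewrite view-old i = refl

  glue-cong : {A : Set} {a a' : A} {b b' : Fin m → A} → a ≡ a' → (∀ i → b i ≡ b' i) →
    ∀ x → glue a b x ≡ glue a' b' x
  glue-cong {a = a} {a'} {b} {b'} ea eb x with view x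
  ... | isLast  = trans (glue-last a b) (trans ea (sym (glue-last a' b')))
  ... | isOld i = trans (glue-old a b i) (trans (eb i) (sym (glue-old a' b' i)))

  extendColour : ∀ {k} → (Fin m → Fin k) → Fin k → Fin (suc m) → Fin k
  extendColour c col = glue col c

  extendColour-last : ∀ {k} (c : Fin m → Fin k) col → extendColour c col last ≡ col
  extendColour-last c col = glue-last _ _

  extendColour-old : ∀ {k} (c : Fin m → Fin k) col i → extendColour c col (inject₁ i) ≡ c i
  extendColour-old c col i = glue-old _ _ i

  addFixed : (Fin m → Fin m) → Fin (suc m) → Fin (suc m)
  addFixed g = glue last (inject₁ ∘ g)

  addFixed-last : ∀ g → addFixed g last ≡ last
  addFixed-last g = glue-last _ _

  addFixed-old : ∀ g i → addFixed g (inject₁ i) ≡ inject₁ (g i)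
  addFixed-old g i = glue-old _ _ i

  -- Insert last into the cycle of g right after p:  p ↦ last ↦ g p.
  afterInsert : (Fin m → Fin m) → Fin m → Fin m → Fin (suc m)
  afterInsert g p i with i FP.≟ p
  ... | yes _ = last
  ... | no _  = inject₁ (g i)

  insertAfter : (Fin m → Fin m) → Fin m → Fin (suc m) → Fin (suc m)
  insertAfter g p = glue (inject₁ (g p)) (afterInsert g p)

  insertAfter-last : ∀ g p → insertAfter g p last ≡ inject₁ (g p)
  insertAfter-last g p = glue-last _ _

  insertAfter-at : ∀ g p i → i ≡ p → insertAfter g p (inject₁ i) ≡ last
  insertAfter-at g p i i≡p = trans (glue-old _ _ i) at
    where
    at : afterInsert g p i ≡ last
    at with i FP.≟ p
    ... | yes _  = refl
    ... | no i≢p = ⊥-elim (i≢p i≡p)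

  insertAfter-old : ∀ g p i → i ≢ p → insertAfter g p (inject₁ i) ≡ inject₁ (g i)
  insertAfter-old g p i i≢p = trans (glue-old _ _ i) old
    where
    old : afterInsert g p i ≡ inject₁ (g i)
    old with i FP.≟ p
    ... | yes i≡p = ⊥-elim (i≢p i≡p)
    ... | no _    = refl

  insertAfter-cong : ∀ {g g'} p → g ≗ g' → insertAfter g p ≗ insertAfter g' p
  insertAfter-cong {g} {g'} p e = glue-cong (cong inject₁ (e p)) old-points
    where
    old-points : ∀ i → afterInsert g p i ≡ afterInsert g' p i
    old-points i with i FP.≟ p
    ... | yes _ = refl
    ... | no _  = cong inject₁ (e i)

  -- Delete last from its cycle: a point mapped to last is sent to the image of last.
  removeLast : (Fin (suc m) → Fin (suc m)) → Fin m → Fin m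
  removeLast f i = glue (glue i id (f last)) id (f (inject₁ i))

  removeLast-old : ∀ f i j → f (inject₁ i) ≡ inject₁ j → removeLast f i ≡ j
  removeLast-old f i j e = trans (cong (glue _ id) e) (glue-old _ id j)

  removeLast-skip : ∀ f i j → f (inject₁ i) ≡ last → f last ≡ inject₁ j → removeLast f i ≡ j
  removeLast-skip f i j e e' = trans (cong (glue _ id) e)
    (trans (glue-last _ id) (trans (cong (glue i id) e') (glue-old i id j)))

  removeLast-cong : ∀ {f f'} → f ≗ f' → removeLast f ≗ removeLast f'
  removeLast-cong e i = cong₂ (λ a b → glue (glue i id a) id b) (e last) (e (inject₁ i))

  removeLast-addFixed : ∀ g → removeLast (addFixed g) ≗ g
  removeLast-addFixed g i = removeLast-old (addFixed g) i (g i) (addFixed-old g i)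

  removeLast-insertAfter : ∀ g p → removeLast (insertAfter g p) ≗ g
  removeLast-insertAfter g p i with i FP.≟ p
  ... | yes i≡p = trans (removeLast-skip (insertAfter g p) i (g p) (insertAfter-at g p i i≡p) (insertAfter-last g p))
                        (cong g (sym i≡p))
  ... | no i≢p  = removeLast-old (insertAfter g p) i (g i) (insertAfter-old g p i i≢p)

  -- The old point mapped to last (or the default d if there is none).
  predLast : (Fin (suc m) → Fin (suc m)) → Fin m → Fin m
  predLast f d with FP.any? (λ i → f (inject₁ i) FP.≟ last)
  ... | yes (i , _) = i
  ... | no _        = d

  predLast-unique : ∀ f d p → f (inject₁ p) ≡ last → IsInjective f → predLast f d ≡ p
  predLast-unique f d p e inj with FP.any? (λ i → f (inject₁ i) FP.≟ last)
  ... | yes (i , e') = FP.inject₁-injective (inj _ _ (trans e' (sym e)))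
  ... | no none      = ⊥-elim (none (p , e))

  cycles-split : ∀ {k} (f : Fin (suc m) → Fin (suc m)) (c : Fin m → Fin k) col₀ col (g : Fin m → Fin m) →
    (∀ i → IsLeader f (inject₁ i) → IsLeader g i) → (∀ i → IsLeader g i → IsLeader f (inject₁ i)) →
    cyclesOfColour f (extendColour c col₀) col ≡ cyclesOfColour g c col + 𝟙 (leaderOf? f (extendColour c col₀) col last)
  cycles-split f c col₀ col g lead lead⁻ = begin
    cyclesOfColour f c' col
      ≡⟨ cycles≡sumFin f c' col ⟩
    sumFin (𝟙 ∘ leaderOf? f c' col)
      ≡⟨ sumFin-last m (𝟙 ∘ leaderOf? f c' col) ⟩
    sumFin (𝟙 ∘ leaderOf? f c' col ∘ inject₁) + 𝟙 (leaderOf? f c' col last)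
      ≡⟨ cong (_+ 𝟙 (leaderOf? f c' col last)) (sumFin-cong {m} old-points) ⟩
    sumFin (𝟙 ∘ leaderOf? g c col) + 𝟙 (leaderOf? f c' col last)
      ≡⟨ cong (_+ 𝟙 (leaderOf? f c' col last)) (sym (cycles≡sumFin g c col)) ⟩
    cyclesOfColour g c col + 𝟙 (leaderOf? f c' col last) ∎
    where
    open ≡-Reasoning
    c' = extendColour c col₀
    old-points : ∀ i → 𝟙 (leaderOf? f c' col (inject₁ i)) ≡ 𝟙 (leaderOf? g c col i)
    old-points i = 𝟙-iff (leaderOf? f c' col (inject₁ i)) (leaderOf? g c col i)
      (λ (L , e) → lead i L , trans (sym (extendColour-old c col₀ i)) e)
      (λ (L , e) → lead⁻ i L , trans (extendColour-old c col₀ i) e)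

  addFixed-injective : ∀ g → IsInjective g → IsInjective (addFixed g)
  addFixed-injective g inj x y e with view x | view y
  ... | isLast  | isLast  = refl
  ... | isLast  | isOld j = ⊥-elim (last≢old _ (trans (sym (addFixed-last g)) (trans e (addFixed-old g j))))
  ... | isOld i | isLast  = ⊥-elim (last≢old _ (sym (trans (sym (addFixed-old g i)) (trans e (addFixed-last g)))))
  ... | isOld i | isOld j =
    cong inject₁ (inj i j (FP.inject₁-injective (trans (sym (addFixed-old g i)) (trans e (addFixed-old g j)))))

  addFixed-perm : ∀ g → IsPerm g → IsPerm (addFixed g)
  addFixed-perm g (inj , surj) = addFixed-injective g inj , surj'
    where
    surj' : ∀ y → ∃ λ x → addFixed g x ≡ y
    surj' y with view y
    ... | isLast  = last , addFixed-last g
    ... | isOld j = let i , e = surj j in inject₁ i , trans (addFixed-old g i) (cong inject₁ e)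

  addFixed-perm⁻ : ∀ g → IsPerm (addFixed g) → IsPerm g
  addFixed-perm⁻ g (inj , surj) = inj' , surj'
    where
    inj' : IsInjective g
    inj' i j e = FP.inject₁-injective (inj (inject₁ i) (inject₁ j)
      (trans (addFixed-old g i) (trans (cong inject₁ e) (sym (addFixed-old g j)))))
    surj' : ∀ j → ∃ λ i → g i ≡ j
    surj' j with surj (inject₁ j)
    ... | x , e with view x
    ... | isLast  = ⊥-elim (last≢old _ (trans (sym (addFixed-last g)) e))
    ... | isOld i = i , FP.inject₁-injective (trans (sym (addFixed-old g i)) e)

  addFixed-colouring : ∀ {k} g (c : Fin m → Fin k) col →
    IsCycleColouring g c → IsCycleColouring (addFixed g) (extendColour c col)
  addFixed-colouring g c col cc x with view x
  ... | isLast  = cong (extendColour c col) (addFixed-last g)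
  ... | isOld i = trans (cong (extendColour c col) (addFixed-old g i))
                    (trans (extendColour-old c col (g i)) (trans (cc i) (sym (extendColour-old c col i))))

  addFixed-colouring⁻ : ∀ {k} g (c : Fin m → Fin k) col →
    IsCycleColouring (addFixed g) (extendColour c col) → IsCycleColouring g c
  addFixed-colouring⁻ g c col cc i =
    trans (sym (extendColour-old c col (g i))) (trans (cong (extendColour c col) (sym (addFixed-old g i)))
      (trans (cc (inject₁ i)) (extendColour-old c col i)))

  iter-addFixed-old : ∀ g r i → iter (addFixed g) r (inject₁ i) ≡ inject₁ (iter g r i)
  iter-addFixed-old g zero    i = refl
  iter-addFixed-old g (suc r) i =
    trans (cong (addFixed g) (iter-addFixed-old g r i)) (addFixed-old g (iter g r i))

  leader-addFixed : ∀ g → IsInjective g → ∀ i → IsLeader (addFixed g) (inject₁ i) → IsLeader g i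
  leader-addFixed g inj i L = leader∞⇒leader i (λ r → subst₂ _≤_ (FP.toℕ-inject₁ i)
     (trans (cong toℕ (iter-addFixed-old g r i)) (FP.toℕ-inject₁ _))
     (leader⇒leader∞ (addFixed-injective g inj) (inject₁ i) L r))

  leader-addFixed⁻ : ∀ g → IsInjective g → ∀ i → IsLeader g i → IsLeader (addFixed g) (inject₁ i)
  leader-addFixed⁻ g inj i L = leader∞⇒leader (inject₁ i) (λ r → subst₂ _≤_ (sym (FP.toℕ-inject₁ i))
     (sym (trans (cong toℕ (iter-addFixed-old g r i)) (FP.toℕ-inject₁ _))) (leader⇒leader∞ inj i L r))

  last-leads-addFixed : ∀ g → IsLeader (addFixed g) last
  last-leads-addFixed g = leader-fixed (addFixed g) last (addFixed-last g)

  cycles-addFixed : ∀ {k} g (c : Fin m → Fin k) col₀ col → IsInjective g →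
    cyclesOfColour (addFixed g) (extendColour c col₀) col
      ≡ cyclesOfColour g c col + 𝟙 (leaderOf? (addFixed g) (extendColour c col₀) col last)
  cycles-addFixed g c col₀ col inj =
    cycles-split (addFixed g) c col₀ col g (leader-addFixed g inj) (leader-addFixed⁻ g inj)

  cycles-addFixed-same : ∀ {k} g (c : Fin m → Fin k) col₀ → IsInjective g →
    cyclesOfColour (addFixed g) (extendColour c col₀) col₀ ≡ suc (cyclesOfColour g c col₀)
  cycles-addFixed-same g c col₀ inj = trans (cycles-addFixed g c col₀ col₀ inj)
    (trans (cong (cyclesOfColour g c col₀ +_)
             (𝟙-yes (leaderOf? (addFixed g) (extendColour c col₀) col₀ last)
                    (last-leads-addFixed g , extendColour-last c col₀)))
           (+-comm _ 1))

  cycles-addFixed-other : ∀ {k} g (c : Fin m → Fin k) col₀ col → col ≢ col₀ → IsInjective g →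
    cyclesOfColour (addFixed g) (extendColour c col₀) col ≡ cyclesOfColour g c col
  cycles-addFixed-other g c col₀ col col≢col₀ inj = trans (cycles-addFixed g c col₀ col inj)
    (trans (cong (cyclesOfColour g c col +_)
             (𝟙-no (leaderOf? (addFixed g) (extendColour c col₀) col last)
                   (λ (_ , e) → col≢col₀ (trans (sym e) (extendColour-last c col₀)))))
           (+-identityʳ _))

  insertAfter-last-apart : ∀ g p → IsInjective g → ∀ j → insertAfter g p last ≢ insertAfter g p (inject₁ j)
  insertAfter-last-apart g p inj j e with j FP.≟ p
  ... | yes j≡p = last≢old _ (sym (trans (sym (insertAfter-last g p)) (trans e (insertAfter-at g p j j≡p))))
  ... | no j≢p  = j≢p (sym (inj p j (FP.inject₁-injective
                    (trans (sym (insertAfter-last g p)) (trans e (insertAfter-old g p j j≢p))))))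

  insertAfter-injective : ∀ g p → IsInjective g → IsInjective (insertAfter g p)
  insertAfter-injective g p inj x y e with view x | view y
  ... | isLast  | isLast  = refl
  ... | isLast  | isOld j = ⊥-elim (insertAfter-last-apart g p inj j e)
  ... | isOld i | isLast  = ⊥-elim (insertAfter-last-apart g p inj i (sym e))
  ... | isOld i | isOld j with i FP.≟ p | j FP.≟ p
  ... | yes i≡p | yes j≡p = cong inject₁ (trans i≡p (sym j≡p))
  ... | yes i≡p | no j≢p  = ⊥-elim (last≢old _ (trans (sym (insertAfter-at g p i i≡p)) (trans e (insertAfter-old g p j j≢p))))
  ... | no i≢p  | yes j≡p = ⊥-elim (last≢old _ (sym (trans (sym (insertAfter-old g p i i≢p)) (trans e (insertAfter-at g p j j≡p)))))
  ... | no i≢p  | no j≢p  = cong inject₁ (inj i j (FP.inject₁-injective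
                              (trans (sym (insertAfter-old g p i i≢p)) (trans e (insertAfter-old g p j j≢p)))))

  insertAfter-perm : ∀ g p → IsPerm g → IsPerm (insertAfter g p)
  insertAfter-perm g p (inj , surj) = insertAfter-injective g p inj , surj'
    where
    surj' : ∀ y → ∃ λ x → insertAfter g p x ≡ y
    surj' y with view y
    ... | isLast = inject₁ p , insertAfter-at g p p refl
    ... | isOld j with surj j
    ... | i , e with i FP.≟ p
    ... | yes i≡p = last , trans (insertAfter-last g p) (cong inject₁ (trans (cong g (sym i≡p)) e))
    ... | no i≢p  = inject₁ i , trans (insertAfter-old g p i i≢p) (cong inject₁ e)

  insertAfter-perm⁻ : ∀ g p → IsPerm (insertAfter g p) → IsPerm g
  insertAfter-perm⁻ g p (inj , surj) = inj' , surj'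
    where
    clash : ∀ i → i ≢ p → g p ≡ g i → ⊥
    clash i i≢p e = last≢old i (inj last (inject₁ i)
      (trans (insertAfter-last g p) (trans (cong inject₁ e) (sym (insertAfter-old g p i i≢p)))))
    inj' : IsInjective g
    inj' i j e with i FP.≟ p | j FP.≟ p
    ... | yes i≡p | yes j≡p = trans i≡p (sym j≡p)
    ... | yes i≡p | no j≢p  = ⊥-elim (clash j j≢p (trans (cong g (sym i≡p)) e))
    ... | no i≢p  | yes j≡p = ⊥-elim (clash i i≢p (trans (cong g (sym j≡p)) (sym e)))
    ... | no i≢p  | no j≢p  = FP.inject₁-injective (inj (inject₁ i) (inject₁ j)
                                (trans (insertAfter-old g p i i≢p) (trans (cong inject₁ e) (sym (insertAfter-old g p j j≢p)))))
    surj' : ∀ j → ∃ λ i → g i ≡ j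
    surj' j with surj (inject₁ j)
    ... | x , e with view x
    ... | isLast = p , FP.inject₁-injective (trans (sym (insertAfter-last g p)) e)
    ... | isOld i with i FP.≟ p
    ... | yes i≡p = ⊥-elim (last≢old _ (trans (sym (insertAfter-at g p i i≡p)) e))
    ... | no i≢p  = i , FP.inject₁-injective (trans (sym (insertAfter-old g p i i≢p)) e)

  -- last joins the cycle of p, so it receives the colour of p.
  insertAfter-colouring : ∀ {k} g p (c : Fin m → Fin k) →
    IsCycleColouring g c → IsCycleColouring (insertAfter g p) (extendColour c (c p))
  insertAfter-colouring g p c cc x with view x
  ... | isLast = trans (cong c' (insertAfter-last g p))
                   (trans (extendColour-old c (c p) (g p)) (trans (cc p) (sym (extendColour-last c (c p)))))
    where c' = extendColour c (c p)
  ... | isOld i with i FP.≟ p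
  ... | yes i≡p = trans (cong (extendColour c (c p)) (insertAfter-at g p i i≡p))
                    (trans (extendColour-last c (c p)) (trans (cong c (sym i≡p)) (sym (extendColour-old c (c p) i))))
  ... | no i≢p  = trans (cong (extendColour c (c p)) (insertAfter-old g p i i≢p))
                    (trans (extendColour-old c (c p) (g i)) (trans (cc i) (sym (extendColour-old c (c p) i))))

  insertAfter-colouring⁻ : ∀ {k} g p (c : Fin m → Fin k) →
    IsCycleColouring (insertAfter g p) (extendColour c (c p)) → IsCycleColouring g c
  insertAfter-colouring⁻ g p c cc i with i FP.≟ p
  ... | yes i≡p = trans (cong (c ∘ g) i≡p) (trans (sym (extendColour-old c (c p) (g p)))
                    (trans (cong (extendColour c (c p)) (sym (insertAfter-last g p))) (trans (cc last)
                    (trans (extendColour-last c (c p)) (cong c (sym i≡p))))))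
  ... | no i≢p  = trans (sym (extendColour-old c (c p) (g i)))
                    (trans (cong (extendColour c (c p)) (sym (insertAfter-old g p i i≢p)))
                    (trans (cc (inject₁ i)) (extendColour-old c (c p) i)))

  iter-insertAfter : ∀ g p i r' → ∃ λ r → iter (insertAfter g p) r (inject₁ i) ≡ inject₁ (iter g r' i)
  iter-insertAfter g p i zero = zero , refl
  iter-insertAfter g p i (suc r') with iter-insertAfter g p i r'
  ... | r , e with iter g r' i FP.≟ p
  ... | yes at-p = suc (suc r) , trans (cong (insertAfter g p ∘ insertAfter g p) e)
                     (trans (cong (insertAfter g p) (insertAfter-at g p _ at-p))
                       (trans (insertAfter-last g p) (cong (inject₁ ∘ g) (sym at-p))))
  ... | no not-p = suc r , trans (cong (insertAfter g p) e) (insertAfter-old g p _ not-p)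

  iter-insertAfter⁻ : ∀ g p i r → ∃ λ r' → (iter (insertAfter g p) r (inject₁ i) ≡ inject₁ (iter g r' i))
                                          ⊎ (iter (insertAfter g p) r (inject₁ i) ≡ last × iter g r' i ≡ p)
  iter-insertAfter⁻ g p i zero = zero , inj₁ refl
  iter-insertAfter⁻ g p i (suc r) with iter-insertAfter⁻ g p i r
  ... | r' , inj₁ e with iter g r' i FP.≟ p
  ... | yes at-p = r' , inj₂ (trans (cong (insertAfter g p) e) (insertAfter-at g p _ at-p) , at-p)
  ... | no not-p = suc r' , inj₁ (trans (cong (insertAfter g p) e) (insertAfter-old g p _ not-p))
  iter-insertAfter⁻ g p i (suc r) | r' , inj₂ (e , at-p) =
    suc r' , inj₁ (trans (cong (insertAfter g p) e) (trans (insertAfter-last g p) (cong (inject₁ ∘ g) (sym at-p))))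

  -- Since last is the largest point, inserting it does not change the old leaders.
  leader-insertAfter : ∀ g p → IsInjective g → ∀ i → IsLeader (insertAfter g p) (inject₁ i) → IsLeader g i
  leader-insertAfter g p inj i L = leader∞⇒leader i λ r' → let r , e = iter-insertAfter g p i r' in
    subst₂ _≤_ (FP.toℕ-inject₁ i) (trans (cong toℕ e) (FP.toℕ-inject₁ _))
      (leader⇒leader∞ (insertAfter-injective g p inj) (inject₁ i) L r)

  leader-insertAfter⁻ : ∀ g p → IsInjective g → ∀ i → IsLeader g i → IsLeader (insertAfter g p) (inject₁ i)
  leader-insertAfter⁻ g p inj i L = leader∞⇒leader (inject₁ i) below
    where
    below : ∀ r → toℕ (inject₁ i) ≤ toℕ (iter (insertAfter g p) r (inject₁ i))
    below r with iter-insertAfter⁻ g p i r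
    ... | r' , inj₁ e = subst₂ _≤_ (sym (FP.toℕ-inject₁ i)) (sym (trans (cong toℕ e) (FP.toℕ-inject₁ _)))
                          (leader⇒leader∞ inj i L r')
    ... | r' , inj₂ (e , _) = subst (λ z → toℕ (inject₁ i) ≤ toℕ z) (sym e)
                          (subst (toℕ (inject₁ i) ≤_) (sym (FP.toℕ-fromℕ m)) (<⇒≤ (FP.inject₁ℕ< i)))

  -- last is not a leader: its successor inject₁ (g p) is smaller.
  last-not-leader : ∀ g p → ¬ IsLeader (insertAfter g p) last
  last-not-leader g p L = <⇒≱ successor<last (L one)
    where
    1<1+m : 1 < suc m
    1<1+m = s≤s (≤-trans (s≤s z≤n) (FP.toℕ<n p))
    one : Fin (suc m)
    one = fromℕ< 1<1+m
    successor<last : toℕ (iter (insertAfter g p) (toℕ one) last) < toℕ last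
    successor<last = subst₂ _<_
      (cong toℕ (sym (trans (cong (λ r → iter (insertAfter g p) r last) (FP.toℕ-fromℕ< 1<1+m)) (insertAfter-last g p))))
      (sym (FP.toℕ-fromℕ m)) (FP.inject₁ℕ< (g p))

  cycles-insertAfter : ∀ {k} g p (c : Fin m → Fin k) → IsInjective g → ∀ col →
    cyclesOfColour (insertAfter g p) (extendColour c (c p)) col ≡ cyclesOfColour g c col
  cycles-insertAfter g p c inj col = begin
    cyclesOfColour (insertAfter g p) (extendColour c (c p)) col
      ≡⟨ cycles-split (insertAfter g p) c (c p) col g
           (leader-insertAfter g p inj) (leader-insertAfter⁻ g p inj) ⟩
    cyclesOfColour g c col + 𝟙 (leaderOf? (insertAfter g p) (extendColour c (c p)) col last)
      ≡⟨ cong (cyclesOfColour g c col +_) (𝟙-no (leaderOf? (insertAfter g p) (extendColour c (c p)) col last) (λ (L , _) → last-not-leader g p L)) ⟩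
    cyclesOfColour g c col + 0
      ≡⟨ +-identityʳ _ ⟩
    cyclesOfColour g c col ∎
    where open ≡-Reasoning

  addFixed-cong : ∀ {g g'} → g ≗ g' → addFixed g ≗ addFixed g'
  addFixed-cong e = glue-cong refl (λ i → cong inject₁ (e i))

  extendColour-cong : ∀ {k} {c c' : Fin m → Fin k} {col col'} → col ≡ col' → c ≗ c' →
    extendColour c col ≗ extendColour c' col'
  extendColour-cong = glue-cong

  extendColour-η : ∀ {k} (c : Fin (suc m) → Fin k) (d : Fin m → Fin k) col →
    col ≡ c last → (∀ i → d i ≡ c (inject₁ i)) → extendColour d col ≗ c
  extendColour-η c d col at-last at-old x with view x
  ... | isLast  = trans (extendColour-last d col) at-last
  ... | isOld i = trans (extendColour-old d col i) (at-old i)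

  addFixed-removeLast : ∀ f → IsInjective f → f last ≡ last → addFixed (removeLast f) ≗ f
  addFixed-removeLast f inj fixed x with view x
  ... | isLast  = trans (addFixed-last (removeLast f)) (sym fixed)
  ... | isOld i with splitLast (f (inject₁ i))
  ... | inj₁ e       = ⊥-elim (last≢old i (sym (inj (inject₁ i) last (trans e (sym fixed)))))
  ... | inj₂ (j , e) = trans (addFixed-old (removeLast f) i) (trans (cong inject₁ (removeLast-old f i j e)) (sym e))

  predLast-spec : ∀ f d → IsPerm f → f last ≢ last → f (inject₁ (predLast f d)) ≡ last
  predLast-spec f d (_ , surj) moved with FP.any? (λ i → f (inject₁ i) FP.≟ last)
  ... | yes (i , e) = e
  ... | no none with surj last
  ...   | x , e with splitLast x
  ...     | inj₁ refl       = ⊥-elim (moved e)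
  ...     | inj₂ (i , refl) = ⊥-elim (none (i , e))

  predLast-insertAfter : ∀ g p d → IsInjective g → predLast (insertAfter g p) d ≡ p
  predLast-insertAfter g p d inj =
    predLast-unique (insertAfter g p) d p (insertAfter-at g p p refl) (insertAfter-injective g p inj)

  insertAfter-removeLast : ∀ f d → IsPerm f → f last ≢ last → insertAfter (removeLast f) (predLast f d) ≗ f
  insertAfter-removeLast f d perm@(inj , _) moved x with view x | splitLast (f last)
  ... | _ | inj₁ fixed = ⊥-elim (moved fixed)
  ... | isLast | inj₂ (j , e) =
    trans (insertAfter-last (removeLast f) p) (trans (cong inject₁ (removeLast-skip f p j to-last e)) (sym e))
    where
    p = predLast f d
    to-last = predLast-spec f d perm moved
  ... | isOld i | _ with i FP.≟ predLast f d
  ...   | yes i≡p = trans (insertAfter-at (removeLast f) (predLast f d) i i≡p)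
                      (sym (trans (cong (f ∘ inject₁) i≡p) (predLast-spec f d perm moved)))
  ...   | no i≢p with splitLast (f (inject₁ i))
  ...     | inj₁ e = ⊥-elim (i≢p (FP.inject₁-injective (inj _ _ (trans e (sym (predLast-spec f d perm moved))))))
  ...     | inj₂ (j , e) = trans (insertAfter-old (removeLast f) (predLast f d) i i≢p)
                             (trans (cong inject₁ (removeLast-old f i j e)) (sym e))

  -- If last is a fixed point of a non-special colour, that colour (which
  -- colours exactly one cycle) appears on no old point.
  fixed-colour-unique : ∀ {k t} (f : Fin (suc m) → Fin (suc m)) (c : Fin (suc m) → Fin (suc k)) →
    IsMCP (suc m) k t (f , c) → f last ≡ last → c last ≢ fzero → ∀ i → c (inject₁ i) ≢ c last
  fixed-colour-unique f c ((inj , _) , cc , _ , others) fixed non-special i same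
    with orbit-leader inj (inject₁ i)
  ... | r , L with splitLast (iter f r (inject₁ i))
  ... | inj₁ e = last≢old i (sym (iter-injective inj r (trans e (sym (iter-fixed f last fixed r)))))
  ... | inj₂ (i' , e) = <⇒≢ two≤count (sym (others (c last) non-special))
    where
    w : Fin (suc m) → ℕ
    w = 𝟙 ∘ leaderOf? f c (c last)
    -- the leader inject₁ i' of the cycle of i, and last, both lead cycles of colour c last
    w-old : w (inject₁ i') ≡ 1
    w-old = 𝟙-yes (leaderOf? f c (c last) (inject₁ i'))
      (subst (IsLeader f) e L , trans (cong c (sym e)) (trans (colour-iter cc r (inject₁ i)) same))
    w-last : w last ≡ 1
    w-last = 𝟙-yes (leaderOf? f c (c last) last) (leader-fixed f last fixed , refl)
    two≤count : 1 < cyclesOfColour f c (c last)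
    two≤count = subst (2 ≤_) (sym (trans (cycles≡sumFin f c (c last)) (sumFin-last m w)))
      (+-mono-≤ (subst (_≤ sumFin (w ∘ inject₁)) w-old (sumFin-≥ (w ∘ inject₁) i')) (≤-reflexive (sym w-last)))

  isMCP-insertAfter : ∀ {k t} g (c : Fin m → Fin (suc k)) p → IsMCP m k t (g , c) →
    IsMCP (suc m) k t (insertAfter g p , extendColour c (c p))
  isMCP-insertAfter g c p (perm , cc , special , others) =
    insertAfter-perm g p perm , insertAfter-colouring g p c cc ,
    trans (cycles-insertAfter g p c (proj₁ perm) fzero) special ,
    (λ col ne → trans (cycles-insertAfter g p c (proj₁ perm) col) (others col ne))

  isMCP-insertAfter⁻ : ∀ {k t} g (c : Fin m → Fin (suc k)) p →
    IsMCP (suc m) k t (insertAfter g p , extendColour c (c p)) → IsMCP m k t (g , c)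
  isMCP-insertAfter⁻ g c p (perm' , cc , special , others) =
    perm , insertAfter-colouring⁻ g p c cc ,
    trans (sym (cycles-insertAfter g p c (proj₁ perm) fzero)) special ,
    (λ col ne → trans (sym (cycles-insertAfter g p c (proj₁ perm) col)) (others col ne))
    where perm = insertAfter-perm⁻ g p perm'

  isMCP-addSpecial : ∀ {k t} g (c : Fin m → Fin (suc k)) → IsMCP m k t (g , c) →
    IsMCP (suc m) k (suc t) (addFixed g , extendColour c fzero)
  isMCP-addSpecial g c (perm , cc , special , others) =
    addFixed-perm g perm , addFixed-colouring g c fzero cc ,
    trans (cycles-addFixed-same g c fzero (proj₁ perm)) (cong suc special) ,
    (λ col ne → trans (cycles-addFixed-other g c fzero col ne (proj₁ perm)) (others col ne))

  isMCP-addSpecial⁻ : ∀ {k t} g (c : Fin m → Fin (suc k)) →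
    IsMCP (suc m) k (suc t) (addFixed g , extendColour c fzero) → IsMCP m k t (g , c)
  isMCP-addSpecial⁻ g c (perm' , cc , special , others) =
    perm , addFixed-colouring⁻ g c fzero cc ,
    suc-injective (trans (sym (cycles-addFixed-same g c fzero (proj₁ perm))) special) ,
    (λ col ne → trans (sym (cycles-addFixed-other g c fzero col ne (proj₁ perm))) (others col ne))
    where perm = addFixed-perm⁻ g perm'

  -- (3) add last as a fixed point of a new non-special colour J = fsuc j; the
  -- old colours are renumbered around J by punchIn J.
  module _ {k : ℕ} (g : Fin m → Fin m) (c : Fin m → Fin (suc k)) (j : Fin (suc k)) where
    private
      J : Fin (suc (suc k))
      J = fsuc j

    addOther : Pairs (suc m) (suc k)
    addOther = addFixed g , extendColour (punchIn J ∘ c) J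

    cycles-addOther-old : IsInjective g → ∀ col →
      cyclesOfColour (proj₁ addOther) (proj₂ addOther) (punchIn J col) ≡ cyclesOfColour g c col
    cycles-addOther-old inj col =
      trans (cycles-addFixed-other g (punchIn J ∘ c) J (punchIn J col) (FP.punchInᵢ≢i J col) inj)
            (cycles-recolour g c (punchIn J) (FP.punchIn-injective J) col)

    cycles-addOther-new : IsInjective g → cyclesOfColour (proj₁ addOther) (proj₂ addOther) J ≡ 1
    cycles-addOther-new inj = trans (cycles-addFixed-same g (punchIn J ∘ c) J inj)
      (cong suc (cycles-absent g (punchIn J ∘ c) J (λ i → FP.punchInᵢ≢i J (c i))))

    isMCP-addOther : ∀ {t} → IsMCP m k t (g , c) → IsMCP (suc m) (suc k) t addOther
    isMCP-addOther (perm , cc , special , others) =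
      addFixed-perm g perm ,
      addFixed-colouring g (punchIn J ∘ c) J (λ i → cong (punchIn J) (cc i)) ,
      trans (cycles-addOther-old (proj₁ perm) fzero) special ,
      non-special
      where
      non-special : ∀ col → col ≢ fzero → cyclesOfColour (proj₁ addOther) (proj₂ addOther) col ≡ 1
      non-special col col≢0 with J FP.≟ col
      ... | yes refl = cycles-addOther-new (proj₁ perm)
      ... | no J≢col = subst (λ z → cyclesOfColour (proj₁ addOther) (proj₂ addOther) z ≡ 1)
                         (FP.punchIn-punchOut J≢col)
                         (trans (cycles-addOther-old (proj₁ perm) (punchOut J≢col))
                           (others (punchOut J≢col) (λ e → col≢0 (trans (sym (FP.punchIn-punchOut J≢col)) (cong (punchIn J) e)))))

    isMCP-addOther⁻ : ∀ {t} → IsMCP (suc m) (suc k) t addOther → IsMCP m k t (g , c)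
    isMCP-addOther⁻ (perm' , cc , special , others) =
      perm ,
      (λ i → FP.punchIn-injective J _ _ (addFixed-colouring⁻ g (punchIn J ∘ c) J cc i)) ,
      trans (sym (cycles-addOther-old (proj₁ perm) fzero)) special ,
      non-special
      where
      perm = addFixed-perm⁻ g perm'
      non-special : ∀ col → col ≢ fzero → cyclesOfColour g c col ≡ 1
      non-special fzero    0≢0 = ⊥-elim (0≢0 refl)
      non-special (fsuc x) _   = trans (sym (cycles-addOther-old (proj₁ perm) (fsuc x))) (others (punchIn J (fsuc x)) (λ ()))

-- 6. The recursion  M(m+1) = m · M(m) + (k-1) · mcp m (k-1) t + mcp m k (t-1)

Fin1-unique : (a b : Fin 1) → a ≡ b
Fin1-unique fzero fzero = refl

colourIndex : ∀ {n} → Fin (suc (suc n)) → Fin (suc n)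
colourIndex fzero    = fzero
colourIndex (fsuc j) = j

colourIndex-fsuc : ∀ {n} (x : Fin (suc (suc n))) → x ≢ fzero → fsuc (colourIndex x) ≡ x
colourIndex-fsuc fzero    x≢0 = ⊥-elim (x≢0 refl)
colourIndex-fsuc (fsuc x) _   = refl

-- Renumber the colours after deleting J (J itself, which will not occur, goes to 0).
deleteColour : ∀ {n} → Fin (suc (suc n)) → Fin (suc (suc n)) → Fin (suc n)
deleteColour J x with J FP.≟ x
... | yes _   = fzero
... | no J≢x  = punchOut J≢x

deleteColour-punchIn : ∀ {n} (J : Fin (suc (suc n))) x → deleteColour J (punchIn J x) ≡ x
deleteColour-punchIn J x with J FP.≟ punchIn J x
... | yes e   = ⊥-elim (FP.punchInᵢ≢i J x (sym e))
... | no _    = trans (FP.punchOut-cong J refl) (FP.punchOut-punchIn J)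

punchIn-deleteColour : ∀ {n} (J : Fin (suc (suc n))) x → x ≢ J → punchIn J (deleteColour J x) ≡ x
punchIn-deleteColour J x x≢J with J FP.≟ x
... | yes e   = ⊥-elim (x≢J (sym e))
... | no J≢x  = FP.punchIn-punchOut J≢x

module Recursion (m k' : ℕ) where
  open Extension {m}

  pairs⁺ : FiniteSetoid (Pairs (suc m) k')
  pairs⁺ = pairSetoid (suc m) k'

  Moved FixedSpecial FixedOther : Pairs (suc m) k' → Set
  Moved        (f , c) = ¬ (f last ≡ last)
  FixedSpecial (f , c) = f last ≡ last × c last ≡ fzero
  FixedOther   (f , c) = f last ≡ last × ¬ (c last ≡ fzero)

  moved? : ∀ x → Dec (Moved x)
  moved? (f , c) = ¬? (f last FP.≟ last)

  fixedSpecial? : ∀ x → Dec (FixedSpecial x)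
  fixedSpecial? (f , c) = (f last FP.≟ last) ×-dec (c last FP.≟ fzero)

  fixedOther? : ∀ x → Dec (FixedOther x)
  fixedOther? (f , c) = (f last FP.≟ last) ×-dec ¬? (c last FP.≟ fzero)

  split-classes : ∀ t → mcp (suc m) (suc k') t ≡
    count pairs⁺ (λ x → isMCP? (suc m) k' t x ×-dec moved? x)
    + count pairs⁺ (λ x → isMCP? (suc m) k' t x ×-dec fixedSpecial? x)
    + count pairs⁺ (λ x → isMCP? (suc m) k' t x ×-dec fixedOther? x)
  split-classes t = trans (mcp≡count (suc m) k' t)
    (count-split₃ pairs⁺ (isMCP? (suc m) k' t) moved? fixedSpecial? fixedOther?
      (λ (f , c) → 𝟙-partition (f last FP.≟ last) (c last FP.≟ fzero)))

  -- Class (1) ≅ MCPs of [m] × choice of the predecessor p of last.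
  moved-correspondence : ∀ t (d : Fin m) →
    Correspondence (pairSetoid m k' ×ₛ finSetoid m) pairs⁺
      (IsMCP m k' t ∘ proj₁) (λ x → IsMCP (suc m) k' t x × Moved x)
  moved-correspondence t d = record
    { to        = to
    ; from      = λ (f , c) → (removeLast f , c ∘ inject₁) , predLast f d
    ; to-cong   = to-cong
    ; from-cong = λ ((perm , _) , moved) (ef , ec) →
        (removeLast-cong ef , ec ∘ inject₁) , predLast-cong ef perm moved
    ; P-resp    = λ ((eg , ec) , _) → isMCP-cong eg ec
    ; Q-resp    = λ (ef , ec) (mc , moved) → isMCP-cong ef ec mc , λ e → moved (trans (ef last) e)
    ; to-Q      = λ ((g , c) , p) mc → isMCP-insertAfter g c p mc ,
                    λ e → last≢old (g p) (sym (trans (sym (insertAfter-last g p)) e))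
    ; to-Q⁻     = λ ((g , c) , p) (mc , _) → isMCP-insertAfter⁻ g c p mc
    ; from-to   = λ ((g , c) , p) (perm , _) →
        (removeLast-insertAfter g p , extendColour-old c (c p)) ,
        predLast-insertAfter g p d (proj₁ perm)
    ; to-from   = to-from
    }
    where
    to : Pairs m k' × Fin m → Pairs (suc m) k'
    to ((g , c) , p) = insertAfter g p , extendColour c (c p)
    to-cong : ∀ {x x'} → IsMCP m k' t (proj₁ x) → FiniteSetoid._≈_ (pairSetoid m k' ×ₛ finSetoid m) x x' →
      FiniteSetoid._≈_ pairs⁺ (to x) (to x')
    to-cong {(g , c) , p} {_ , .p} _ ((eg , ec) , refl) = insertAfter-cong p eg , extendColour-cong (ec p) ec
    predLast-cong : ∀ {f f'} → f ≗ f' → IsPerm f → f last ≢ last → predLast f d ≡ predLast f' d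
    predLast-cong {f} {f'} ef perm@(inj , _) moved = sym (predLast-unique f' d (predLast f d)
      (trans (sym (ef _)) (predLast-spec f d perm moved))
      (λ i j e → inj i j (trans (ef i) (trans e (sym (ef j))))))
    to-from : ∀ y → IsMCP (suc m) k' t y × Moved y → FiniteSetoid._≈_ pairs⁺ (to ((removeLast (proj₁ y) , proj₂ y ∘ inject₁) , predLast (proj₁ y) d)) y
    to-from (f , c) ((perm , cc , _) , moved) =
      insertAfter-removeLast f d perm moved ,
      extendColour-η c (c ∘ inject₁) (c (inject₁ p))
        (trans (sym (cc (inject₁ p))) (cong c (predLast-spec f d perm moved))) (λ _ → refl)
      where p = predLast f d

  count-moved : ∀ t (d : Fin m) → count pairs⁺ (λ x → isMCP? (suc m) k' t x ×-dec moved? x) ≡ mcp m (suc k') t * m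
  count-moved t d = begin
    count pairs⁺ (λ x → isMCP? (suc m) k' t x ×-dec moved? x)
      ≡⟨ sym (count-correspondence _ _ (moved-correspondence t d)) ⟩
    count (pairSetoid m k' ×ₛ finSetoid m) (isMCP? m k' t ∘ proj₁)
      ≡⟨ count-×ˡ (pairSetoid m k') (finSetoid m) (isMCP? m k' t) ⟩
    count (pairSetoid m k') (isMCP? m k' t) * length (allFin m)
      ≡⟨ cong₂ _*_ (sym (mcp≡count m k' t)) (length-tabulate id) ⟩
    mcp m (suc k') t * m ∎
    where open ≡-Reasoning

  count-moved-[1] : ∀ t → m ≡ 0 → count pairs⁺ (λ x → isMCP? (suc m) k' t x ×-dec moved? x) ≡ 0
  count-moved-[1] t refl = trans (sumL-cong (FiniteSetoid.enum pairs⁺)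
      (λ x → 𝟙-no (isMCP? 1 k' t x ×-dec moved? x) (λ (_ , moved) → moved (Fin1-unique _ _))))
    (sumL-0 (FiniteSetoid.enum pairs⁺))

  fixedSpecial-correspondence : ∀ t →
    Correspondence (pairSetoid m k') pairs⁺ (IsMCP m k' t) (λ x → IsMCP (suc m) k' (suc t) x × FixedSpecial x)
  fixedSpecial-correspondence t = record
    { to        = λ (g , c) → addFixed g , extendColour c fzero
    ; from      = λ (f , c) → removeLast f , c ∘ inject₁
    ; to-cong   = λ _ (eg , ec) → addFixed-cong eg , extendColour-cong refl ec
    ; from-cong = λ _ (ef , ec) → removeLast-cong ef , ec ∘ inject₁
    ; P-resp    = λ (eg , ec) → isMCP-cong eg ec
    ; Q-resp    = λ (ef , ec) (mc , fixed , special) →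
        isMCP-cong ef ec mc , trans (sym (ef last)) fixed , trans (sym (ec last)) special
    ; to-Q      = λ (g , c) mc → isMCP-addSpecial g c mc , addFixed-last g , extendColour-last c fzero
    ; to-Q⁻     = λ (g , c) (mc , _) → isMCP-addSpecial⁻ g c mc
    ; from-to   = λ (g , c) _ → removeLast-addFixed g , extendColour-old c fzero
    ; to-from   = λ (f , c) (((inj , _) , _) , fixed , special) →
        addFixed-removeLast f inj fixed , extendColour-η c (c ∘ inject₁) fzero (sym special) (λ _ → refl)
    }

  count-fixedSpecial : ∀ t → count pairs⁺ (λ x → isMCP? (suc m) k' (suc t) x ×-dec fixedSpecial? x) ≡ mcp m (suc k') t
  count-fixedSpecial t =
    sym (trans (mcp≡count m k' t) (count-correspondence _ _ (fixedSpecial-correspondence t)))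

  -- With k = 1 there is no non-special colour.
  count-fixedOther-k1 : ∀ t → k' ≡ 0 → count pairs⁺ (λ x → isMCP? (suc m) k' t x ×-dec fixedOther? x) ≡ 0
  count-fixedOther-k1 t refl = trans (sumL-cong (FiniteSetoid.enum pairs⁺)
      (λ x → 𝟙-no (isMCP? (suc m) 0 t x ×-dec fixedOther? x) (λ (_ , _ , other) → other (Fin1-unique _ _))))
    (sumL-0 (FiniteSetoid.enum pairs⁺))

-- Class (3), for k = k'' + 2 colours: MCPs of [m] with one colour less,
-- together with the index j of the colour fsuc j of the fixed point last.
module RecursionOther (m k : ℕ) where
  open Extension {m}
  open Recursion m (suc k)

  fixedOther-correspondence : ∀ t →
    Correspondence (finSetoid (suc k) ×ₛ pairSetoid m k) pairs⁺
      (IsMCP m k t ∘ proj₂) (λ x → IsMCP (suc m) (suc k) t x × FixedOther x)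
  fixedOther-correspondence t = record
    { to        = to
    ; from      = λ (f , c) → colourIndex (c last) , (removeLast f , deleteColour (c last) ∘ c ∘ inject₁)
    ; to-cong   = to-cong
    ; from-cong = λ _ (ef , ec) →
        cong colourIndex (ec last) , (removeLast-cong ef , λ i → cong₂ deleteColour (ec last) (ec (inject₁ i)))
    ; P-resp    = λ (_ , (eg , ec)) → isMCP-cong eg ec
    ; Q-resp    = λ (ef , ec) (mc , fixed , other) →
        isMCP-cong ef ec mc , trans (sym (ef last)) fixed , λ e → other (trans (ec last) e)
    ; to-Q      = λ (j , (g , c)) mc → isMCP-addOther g c j mc , addFixed-last g ,
        λ e → FP.0≢1+n (sym (trans (sym (extendColour-last (punchIn (fsuc j) ∘ c) (fsuc j))) e))
    ; to-Q⁻     = λ (j , (g , c)) (mc , _) → isMCP-addOther⁻ g c j mc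
    ; from-to   = λ (j , (g , c)) _ →
        cong colourIndex (extendColour-last (punchIn (fsuc j) ∘ c) (fsuc j)) ,
        (removeLast-addFixed g ,
         λ i → trans (cong₂ deleteColour (extendColour-last (punchIn (fsuc j) ∘ c) (fsuc j))
                                         (extendColour-old (punchIn (fsuc j) ∘ c) (fsuc j) i))
                     (deleteColour-punchIn (fsuc j) (c i)))
    ; to-from   = to-from
    }
    where
    to : Fin (suc k) × Pairs m k → Pairs (suc m) (suc k)
    to (j , (g , c)) = addOther g c j
    to-cong : ∀ {x x'} → IsMCP m k t (proj₂ x) → FiniteSetoid._≈_ (finSetoid (suc k) ×ₛ pairSetoid m k) x x' →
      FiniteSetoid._≈_ pairs⁺ (to x) (to x')
    to-cong {j , _} {.j , _} _ (refl , (eg , ec)) =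
      addFixed-cong eg , extendColour-cong refl (λ i → cong (punchIn (fsuc j)) (ec i))
    to-from : ∀ y → IsMCP (suc m) (suc k) t y × FixedOther y →
      FiniteSetoid._≈_ pairs⁺ (to (colourIndex (proj₂ y last) ,
                               (removeLast (proj₁ y) , deleteColour (proj₂ y last) ∘ proj₂ y ∘ inject₁))) y
    to-from (f , c) (mc@((inj , _) , _) , fixed , other) =
      addFixed-removeLast f inj fixed ,
      extendColour-η c (punchIn J ∘ deleteColour (c last) ∘ c ∘ inject₁) J J≡c-last
        (λ i → trans (cong (λ z → punchIn z (deleteColour (c last) (c (inject₁ i)))) J≡c-last)
                     (punchIn-deleteColour (c last) (c (inject₁ i)) (fixed-colour-unique f c mc fixed other i)))
      where
      J = fsuc (colourIndex (c last))
      J≡c-last : J ≡ c last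
      J≡c-last = colourIndex-fsuc (c last) other

  count-fixedOther : ∀ t → count pairs⁺ (λ x → isMCP? (suc m) (suc k) t x ×-dec fixedOther? x) ≡ suc k * mcp m (suc k) t
  count-fixedOther t = begin
    count pairs⁺ (λ x → isMCP? (suc m) (suc k) t x ×-dec fixedOther? x)
      ≡⟨ sym (count-correspondence _ _ (fixedOther-correspondence t)) ⟩
    count (finSetoid (suc k) ×ₛ pairSetoid m k) (isMCP? m k t ∘ proj₂)
      ≡⟨ count-×ʳ (finSetoid (suc k)) (pairSetoid m k) (isMCP? m k t) ⟩
    length (allFin (suc k)) * count (pairSetoid m k) (isMCP? m k t)
      ≡⟨ cong₂ _*_ (length-tabulate {n = suc k} id) (sym (mcp≡count m k t)) ⟩
    suc k * mcp m (suc k) t ∎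
    where open ≡-Reasoning

count-moved-all : ∀ m k' t → count (Recursion.pairs⁺ m k') (λ x → isMCP? (suc m) k' t x ×-dec Recursion.moved? m k' x)
                           ≡ m * mcp m (suc k') t
count-moved-all zero     k' t = Recursion.count-moved-[1] zero k' t refl
count-moved-all (suc m') k' t = trans (Recursion.count-moved (suc m') k' t fzero) (*-comm _ (suc m'))

count-fixedOther-all : ∀ m k' t → count (Recursion.pairs⁺ m k') (λ x → isMCP? (suc m) k' t x ×-dec Recursion.fixedOther? m k' x)
                                ≡ k' * mcp m k' t
count-fixedOther-all m zero    t = Recursion.count-fixedOther-k1 m zero t refl
count-fixedOther-all m (suc k) t = RecursionOther.count-fixedOther m k t

mcp-recursion : ∀ m k' t' → mcp (suc m) (suc k') (suc t')
  ≡ m * mcp m (suc k') (suc t') + (k' * mcp m k' (suc t') + mcp m (suc k') t')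
mcp-recursion m k' t' = begin
  mcp (suc m) (suc k') (suc t')
    ≡⟨ Recursion.split-classes m k' (suc t') ⟩
  moved + fixedSpecial + fixedOther
    ≡⟨ cong₂ _+_ (cong₂ _+_ (count-moved-all m k' (suc t')) (Recursion.count-fixedSpecial m k' t'))
                 (count-fixedOther-all m k' (suc t')) ⟩
  m * mcp m (suc k') (suc t') + mcp m (suc k') t' + k' * mcp m k' (suc t')
    ≡⟨ rearrange (m * mcp m (suc k') (suc t')) (mcp m (suc k') t') (k' * mcp m k' (suc t')) ⟩
  m * mcp m (suc k') (suc t') + (k' * mcp m k' (suc t') + mcp m (suc k') t') ∎
  where
  open ≡-Reasoning
  open Recursion m k' using (pairs⁺; moved?; fixedSpecial?; fixedOther?)
  moved fixedSpecial fixedOther : ℕ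
  moved        = count pairs⁺ (λ x → isMCP? (suc m) k' (suc t') x ×-dec moved? x)
  fixedSpecial = count pairs⁺ (λ x → isMCP? (suc m) k' (suc t') x ×-dec fixedSpecial? x)
  fixedOther   = count pairs⁺ (λ x → isMCP? (suc m) k' (suc t') x ×-dec fixedOther? x)
  rearrange : ∀ a b c → a + b + c ≡ a + (c + b)
  rearrange = solve-∀

-- 7. Unrolling the recursion

C*factorials : ∀ n k → k ≤ n → (n C k) * (k ! * (n ∸ k) !) ≡ n !
C*factorials n k k≤n = trans (cong (_* (k ! * (n ∸ k) !)) (nCk≡n!/k![n-k]! k≤n))
  (m/n*n≡m {{k !* (n ∸ k) !≢0}} (k![n∸k]!∣n! k≤n))

nC0≡1 : ∀ n → n C 0 ≡ 1
nC0≡1 n = trans (nCk≡nC[n∸k] {k = 0} {n = n} z≤n) (nCn≡1 n)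

-- The falling factorial i!·C(m,i) = m(m-1)⋯(m-i+1) satisfies the step (m+1)_(i+1) = (m+1)·(m)_i.
falling-step : ∀ m i → suc i ! * (suc m C suc i) ≡ suc m * (i ! * (m C i))
falling-step m i with i ≤? m
... | no i≰m rewrite k>n⇒nCk≡0 (≰⇒> i≰m) | k>n⇒nCk≡0 (s≤s (≰⇒> i≰m)) =
  trans (*-zeroʳ (suc i !)) (sym (trans (cong (suc m *_) (*-zeroʳ (i !))) (*-zeroʳ (suc m))))
... | yes i≤m = *-cancelʳ-≡ _ _ ((m ∸ i) !) {{(m ∸ i) !≢0}} (begin
    suc i ! * (suc m C suc i) * (m ∸ i) !     ≡⟨ regroup₁ (suc i !) (suc m C suc i) ((m ∸ i) !) ⟩
    (suc m C suc i) * (suc i ! * (m ∸ i) !)   ≡⟨ C*factorials (suc m) (suc i) (s≤s i≤m) ⟩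
    suc m * m !                               ≡⟨ cong (suc m *_) (sym (C*factorials m i i≤m)) ⟩
    suc m * ((m C i) * (i ! * (m ∸ i) !))     ≡⟨ regroup₂ (suc m) (i !) (m C i) ((m ∸ i) !) ⟩
    suc m * (i ! * (m C i)) * (m ∸ i) ! ∎)
  where
  open ≡-Reasoning
  regroup₁ : ∀ a c d → a * c * d ≡ c * (a * d)
  regroup₁ = solve-∀
  regroup₂ : ∀ s a c d → s * (c * (a * d)) ≡ s * (a * c) * d
  regroup₂ = solve-∀

sumBelow : ℕ → (ℕ → ℕ) → ℕ
sumBelow zero    w = 0
sumBelow (suc n) w = w 0 + sumBelow n (w ∘ suc)

sumBelow-cong : ∀ n {f g : ℕ → ℕ} → (∀ i → f i ≡ g i) → sumBelow n f ≡ sumBelow n g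
sumBelow-cong zero    e = refl
sumBelow-cong (suc n) e = cong₂ _+_ (e 0) (sumBelow-cong n (e ∘ suc))

sumBelow-*ˡ : ∀ n c (f : ℕ → ℕ) → sumBelow n (λ i → c * f i) ≡ c * sumBelow n f
sumBelow-*ˡ zero    c f = sym (*-zeroʳ c)
sumBelow-*ˡ (suc n) c f = trans (cong (c * f 0 +_) (sumBelow-*ˡ n c (f ∘ suc))) (sym (*-distribˡ-+ c (f 0) _))

sum-applyUpTo : ∀ (h g : ℕ → ℕ) n → sum (map h (applyUpTo g n)) ≡ sumBelow n (h ∘ g)
sum-applyUpTo h g zero    = refl
sum-applyUpTo h g (suc n) = cong (h (g 0) +_) (sum-applyUpTo h (g ∘ suc) n)

unroll : (M A : ℕ → ℕ) → (∀ m → M (suc m) ≡ m * M m + A m) →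
  ∀ m → M (suc m) ≡ sumBelow (suc m) (λ i → i ! * (m C i) * A (m ∸ i))
unroll M A step zero = begin
  M 1                   ≡⟨ step 0 ⟩
  A 0                     ≡⟨ sym (*-identityˡ (A 0)) ⟩
  1 * A 0                 ≡⟨ cong (λ z → 1 * z * A 0) (sym (nC0≡1 0)) ⟩
  0 ! * (0 C 0) * A 0     ≡⟨ sym (+-identityʳ _) ⟩
  0 ! * (0 C 0) * A 0 + 0 ∎
  where open ≡-Reasoning
unroll M A step (suc m) = begin
  M (suc (suc m))                             ≡⟨ step (suc m) ⟩
  suc m * M (suc m) + A (suc m)               ≡⟨ cong (λ z → suc m * z + A (suc m)) (unroll M A step m) ⟩
  suc m * sumBelow (suc m) term + A (suc m)   ≡⟨ +-comm _ (A (suc m)) ⟩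
  A (suc m) + suc m * sumBelow (suc m) term   ≡⟨ cong₂ _+_ first-term (sym shifted-terms) ⟩
  sumBelow (suc (suc m)) (λ i → i ! * (suc m C i) * A (suc m ∸ i)) ∎
  where
  open ≡-Reasoning
  term : ℕ → ℕ
  term i = i ! * (m C i) * A (m ∸ i)
  first-term : A (suc m) ≡ 0 ! * (suc m C 0) * A (suc m)
  first-term = sym (trans (cong (λ z → 1 * z * A (suc m)) (nC0≡1 (suc m))) (*-identityˡ (A (suc m))))
  shifted-terms : sumBelow (suc m) (λ i → suc i ! * (suc m C suc i) * A (m ∸ i)) ≡ suc m * sumBelow (suc m) term
  shifted-terms = trans
    (sumBelow-cong (suc m) (λ i → trans (cong (_* A (m ∸ i)) (falling-step m i)) (*-assoc (suc m) (i ! * (m C i)) (A (m ∸ i)))))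
    (sumBelow-*ˡ (suc m) (suc m) term)

mainTheorem8 : (n k t : ℕ) → 1 ≤ n → 1 ≤ k → 1 ≤ t → k ≤ n → t ≤ n →
    mcp n k t ≡
      sum (map (λ j → ((j ∸ 1) !) * ((n ∸ 1) C (j ∸ 1))
                       * ((k ∸ 1) * mcp (n ∸ j) (k ∸ 1) t + mcp (n ∸ j) k (t ∸ 1)))
               (applyUpTo suc n))
mainTheorem8 (suc m) (suc k') (suc t') _ _ _ _ _ = begin
  mcp (suc m) (suc k') (suc t')
    ≡⟨ unroll (λ x → mcp x (suc k') (suc t')) A (λ x → mcp-recursion x k' t') m ⟩
  sumBelow (suc m) (λ i → i ! * (m C i) * A (m ∸ i))
    ≡⟨ sym (sum-applyUpTo _ suc (suc m)) ⟩
  sum (map (λ j → (j ∸ 1) ! * (m C (j ∸ 1)) * A (suc m ∸ j)) (applyUpTo suc (suc m))) ∎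
  where
  open ≡-Reasoning
  A : ℕ → ℕ
  A x = k' * mcp x k' (suc t') + mcp x (suc k') t'
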